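{- Let $t$ be a PPC term and $V,M$ lists of lists of symbols for which $\mathcal T_{V,M}(t)$ is defined. If $t\to_{PPC}t'$, then $\mathcal T_{V,M}(t)\to_{dB}\mathcal T_{V,M}(t')$.
   Context: **PPC.** Fix a countably infinite set of symbols. Terms: $t::=x\mid\hat x\mid t\,t\mid\lambda_\theta p.s$, where $\theta$ is a list of symbols binding the matchables $\hat x$ ($x\in\theta$) in $p$ and the variables $x$ in $s$. Terms are taken modulo $\alpha$-conversion. Substitutions act capture-avoidingly on variables. A match is a substitution, $\mathtt{fail}$ or $\mathtt{wait}$ (decided if not $\mathtt{wait}$). Data structures are $d::=\hat x\mid d\,t$; matchable forms are $m::=d\mid\lambda_\theta t.t$. $\mu\uplus\mu'$ is $\mathtt{fail}$ if either match is $\mathtt{fail}$; else $\mathtt{wait}$ if either is $\mathtt{wait}$; else $\mathtt{fail}$ if the domains intersect; else the union. Matching $\{p/u\}_\theta$ (first applicable clause): 1. $\{\hat x/u\}_\theta=\{x\mapsto u\}$ if $x\in\theta$; 2. $\{\hat x/\hat x\}_\theta=\{\}$ if $x\notin\theta$; 3. $\{p\,q/t\,u\}_\theta=\{p/t\}_\theta\uplus\{q/u\}_\theta$ if both are matchable forms; 4. $\mathtt{fail}$ if $p,u$ are matchable forms; 5. $\mathtt{wait}$ otherwise. A substitution result whose domain is not $\theta$ becomes $\mathtt{fail}$. $\mathtt{fail}$ applied to any term gives $\lambda_{[x]}\hat x.x$. $\to_{PPC}$ is the contextual closure of $(\lambda_\theta p.s)u\to\{p/u\}_\theta s$ when the match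 is decided. **PPC_dB.** Terms: $t::=\mathsf v_{i,j}\mid\mathsf m_{i,j}\mid t\,t\mid\lambda_np.s$. - $\uparrow^{\mathsf v}_k\mathsf v_{i,j}=\mathsf v_{i+1,j}$ if $i>k$, else unchanged; matchables unchanged; homomorphic on applications; $\uparrow^{\mathsf v}_k(\lambda_np.s)=\lambda_n\uparrow^{\mathsf v}_kp.\uparrow^{\mathsf v}_{k+1}s$. - $\uparrow^{\mathsf m}_k$ is symmetric, with $\uparrow^{\mathsf m}_k(\lambda_np.s)=\lambda_n\uparrow^{\mathsf m}_{k+1}p.\uparrow^{\mathsf m}_ks$. - $\downarrow^{\mathsf v}_k$ is like $\uparrow^{\mathsf v}_k$ but subtracts $1$. - The default depth is $0$. Substitution at level $i$, $\{\mathsf v_{i,j}\mapsto u_j\}_{j\in J}$: - maps $\mathsf v_{i,k}\mapsto u_k$ ($k\in J$), leaves $\mathsf v_{i',k}$ ($i'\ne i$) and matchables unchanged; - is homomorphic on applications; - maps $\lambda_np.s\mapsto\lambda_n(\{\mathsf v_{i,j}\mapsto\uparrow^{\mathsf m}u_j\}p).(\{\mathsf v_{i+1,j}\mapsto\uparrow^{\mathsf v}u_j\}s)$. Data structures are $d::=\mathsf m_{i,j}\mid d\,t$; matchable forms are $m::=d\mid\lambda_nt.t$. Matching $\{p/u\}_n$: $\{\mathsf m_{1,j}/u\}_n=\{\mathsf v_{1,j}\mapsto u\}$; $\{\mathsf m_{i+1,j}/\mathsf m_{i,j}\}_n=\{\}$; then the application, $\mathtt{fail}$ and $\mathtt{wait}$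 clauses as in PPC. A result whose domain is not $\{\mathsf v_{1,1},\dots,\mathsf v_{1,n}\}$ becomes $\mathtt{fail}$. $\mathtt{fail}$ applied to any term gives $\lambda_1\mathsf m_{1,1}.\mathsf v_{1,1}$. $\to_{dB}$ is the contextual closure of $(\lambda_np.s)u\to\downarrow^{\mathsf v}(\{p/\uparrow^{\mathsf v}u\}_ns)$ when the match is decided. Equality is modulo permutation of the secondary indices bound by the same abstraction. **Translation.** For lists of lists of symbols ($V_{ij}$ is the $j$-th element of the $i$-th list; $\theta++V=[\theta]++V$): - $\mathcal T_{V,M}(x)=\mathsf v_{i,j}$ with $i=\min\{i'\mid x\in V_{i'}\}$ and $j=\min\{j'\mid x=V_{ij'}\}$; - $\mathcal T_{V,M}(\hat x)=\mathsf m_{i,j}$, likewise using $M$; - homomorphic on applications; - $\mathcal T_{V,M}(\lambda_\theta p.s)=\lambda_{|\theta|}\mathcal T_{V,\theta++M}(p).\mathcal T_{\theta++V,M}(s)$. $\mathcal T_{V,M}(t)$ is defined when the free variables of $t$ lie in $V$ and its free matchables lie in $M$. -}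

module Defs where

open import Data.Nat using (ℕ; zero; suc; _≡ᵇ_; _<ᵇ_; _<?_; _∸_)
open import Data.Bool using (Bool; true; false; _∧_; _∨_; not; if_then_else_)
open import Data.List using (List; []; _∷_; _++_; map; length)
open import Data.Maybe using (Maybe; just; nothing)
open import Data.Product using (_×_; _,_; Σ; ∃)
open import Data.Fin using (toℕ; fromℕ<)
open import Data.Fin.Permutation using (Permutation′; _⟨$⟩ʳ_)
open import Data.List.Relation.Unary.Unique.Propositional using (Unique)
open import Relation.Nullary using (yes; no)
open import Relation.Binary.PropositionalEquality using (_≡_)

Sym : Set
Sym = ℕ

allB : {A : Set} → (A → Bool) → List A → Bool
allB f []       = true
allB f (x ∷ xs) = f x ∧ allB f xs

elem : Sym → List Sym → Bool
elem x []       = false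
elem x (y ∷ ys) = (x ≡ᵇ y) ∨ elem x ys

-- PPC raw terms (α-conversion handled by the relation _≈α_ below).
-- lam θ p s  is  λ_θ p. s

data Term : Set where
  var : Sym → Term
  mat : Sym → Term
  app : Term → Term → Term
  lam : List Sym → Term → Term → Term

occurs : Sym → Term → Bool
occurs y (var x)     = y ≡ᵇ x
occurs y (mat x)     = y ≡ᵇ x
occurs y (app t u)   = occurs y t ∨ occurs y u
occurs y (lam θ p s) = elem y θ ∨ occurs y p ∨ occurs y s

binders : Term → List Sym
binders (var x)     = []
binders (mat x)     = []
binders (app t u)   = binders t ++ binders u
binders (lam θ p s) = θ ++ binders p ++ binders s

UniqueBinders : Term → Set
UniqueBinders (var x)     = ⊤′ where open import Data.Unit using () renaming (⊤ to ⊤′)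
UniqueBinders (mat x)     = ⊤′ where open import Data.Unit using () renaming (⊤ to ⊤′)
UniqueBinders (app t u)   = UniqueBinders t × UniqueBinders u
UniqueBinders (lam θ p s) = Unique θ × UniqueBinders p × UniqueBinders s

renV : Sym → Sym → Term → Term
renV x y (var z)     = if z ≡ᵇ x then var y else var z
renV x y (mat z)     = mat z
renV x y (app t u)   = app (renV x y t) (renV x y u)
renV x y (lam θ p s) = lam θ (renV x y p) (if elem x θ then s else renV x y s)

renM : Sym → Sym → Term → Term
renM x y (var z)     = var z
renM x y (mat z)     = if z ≡ᵇ x then mat y else mat z
renM x y (app t u)   = app (renM x y t) (renM x y u)
renM x y (lam θ p s) = lam θ (if elem x θ then p else renM x y p) (renM x y s)

rnSym : Sym → Sym → Sym → Sym
rnSym x y z = if z ≡ᵇ x then y else z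

data _≈α_ : Term → Term → Set where
  α-refl  : ∀ {t} → t ≈α t
  α-sym   : ∀ {t u} → t ≈α u → u ≈α t
  α-trans : ∀ {t u w} → t ≈α u → u ≈α w → t ≈α w
  α-app   : ∀ {t t' u u'} → t ≈α t' → u ≈α u' → app t u ≈α app t' u'
  α-lam   : ∀ {θ p p' s s'} → p ≈α p' → s ≈α s' → lam θ p s ≈α lam θ p' s'
  α-ren   : ∀ {θ p s} x y → elem x θ ≡ true → occurs y (lam θ p s) ≡ false →
            lam θ p s ≈α lam (map (rnSym x y) θ) (renM x y p) (renV x y s)

data Match (A : Set) : Set where
  ok   : A → Match A
  fail : Match A
  wait : Match A

PSubst : Set
PSubst = List (Sym × Term)

pdom : PSubst → List Sym
pdom = map (λ { (x , _) → x })

isDS : Term → Bool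
isDS (mat _)   = true
isDS (app d _) = isDS d
isDS _         = false

isMF : Term → Bool
isMF (lam _ _ _) = true
isMF t           = isDS t

disjointB : List Sym → List Sym → Bool
disjointB xs ys = allB (λ x → not (elem x ys)) xs

_⊎P_ : Match PSubst → Match PSubst → Match PSubst
fail ⊎P _    = fail
_    ⊎P fail = fail
wait ⊎P _    = wait
_    ⊎P wait = wait
ok σ ⊎P ok τ = if disjointB (pdom σ) (pdom τ) then ok (σ ++ τ) else fail

pmatchRest : List Sym → Term → Term → Match PSubst

pmatch₀ : List Sym → Term → Term → Match PSubst
pmatch₀ θ (mat x) u with elem x θ
... | true  = ok ((x , u) ∷ [])
... | false with u
...   | mat y = if x ≡ᵇ y then ok [] else pmatchRest θ (mat x) (mat y)
...   | u'    = pmatchRest θ (mat x) u'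
pmatch₀ θ p u = pmatchRest θ p u

pmatchRest θ (app p q) (app t u) with isMF (app p q) ∧ isMF (app t u)
... | true  = pmatch₀ θ p t ⊎P pmatch₀ θ q u
... | false = if isMF (app p q) ∧ isMF (app t u) then fail else wait
pmatchRest θ p u = if isMF p ∧ isMF u then fail else wait

sameSet : List Sym → List Sym → Bool
sameSet xs ys = allB (λ x → elem x ys) xs ∧ allB (λ y → elem y xs) ys

pmatch : List Sym → Term → Term → Match PSubst
pmatch θ p u with pmatch₀ θ p u
... | ok σ = if sameSet (pdom σ) θ then ok σ else fail
... | r    = r

-- naive substitution (used only when no capture can occur)
plookup : Sym → PSubst → Maybe Term
plookup x []            = nothing
plookup x ((y , u) ∷ σ) = if x ≡ᵇ y then just u else plookup x σ

remove : List Sym → PSubst → PSubst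
remove θ []            = []
remove θ ((y , u) ∷ σ) = if elem y θ then remove θ σ else (y , u) ∷ remove θ σ

psubst : PSubst → Term → Term
psubst σ (var x) with plookup x σ
... | just u  = u
... | nothing = var x
psubst σ (mat x)     = mat x
psubst σ (app t u)   = app (psubst σ t) (psubst σ u)
psubst σ (lam θ p s) = lam θ (psubst σ p) (psubst (remove θ σ) s)

noCapture : PSubst → Term → Bool
noCapture σ s = allB (λ z → allB (λ { (_ , u) → not (occurs z u) }) σ) (binders s)

data _⟶ʳ_ : Term → Term → Set where
  β-ok   : ∀ {θ p s u σ} → pmatch θ p u ≡ ok σ → noCapture σ s ≡ true →
           app (lam θ p s) u ⟶ʳ psubst σ s
  β-fail : ∀ {θ p s u} → pmatch θ p u ≡ fail →
           app (lam θ p s) u ⟶ʳ lam (0 ∷ []) (mat 0) (var 0)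
  ξ-appˡ : ∀ {t t' u} → t ⟶ʳ t' → app t u ⟶ʳ app t' u
  ξ-appʳ : ∀ {t u u'} → u ⟶ʳ u' → app t u ⟶ʳ app t u'
  ξ-pat  : ∀ {θ p p' s} → p ⟶ʳ p' → lam θ p s ⟶ʳ lam θ p' s
  ξ-body : ∀ {θ p s s'} → s ⟶ʳ s' → lam θ p s ⟶ʳ lam θ p s'

_⟶PPC_ : Term → Term → Set
t ⟶PPC t' = Σ Term λ t₁ → Σ Term λ t₂ → t ≈α t₁ × t₁ ⟶ʳ t₂ × t₂ ≈α t'

-- PPC_dB terms; v i j = 𝗏_{i,j}, m i j = 𝗆_{i,j}; lam n p s = λ_n p. s

data DB : Set where
  v   : ℕ → ℕ → DB
  m   : ℕ → ℕ → DB
  app : DB → DB → DB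
  lam : ℕ → DB → DB → DB

↑v : ℕ → DB → DB
↑v k (v i j)     = if k <ᵇ i then v (suc i) j else v i j
↑v k (m i j)     = m i j
↑v k (app t u)   = app (↑v k t) (↑v k u)
↑v k (lam n p s) = lam n (↑v k p) (↑v (suc k) s)

↑m : ℕ → DB → DB
↑m k (v i j)     = v i j
↑m k (m i j)     = if k <ᵇ i then m (suc i) j else m i j
↑m k (app t u)   = app (↑m k t) (↑m k u)
↑m k (lam n p s) = lam n (↑m (suc k) p) (↑m k s)

↓v : ℕ → DB → DB
↓v k (v i j)     = if k <ᵇ i then v (i ∸ 1) j else v i j
↓v k (m i j)     = m i j
↓v k (app t u)   = app (↓v k t) (↓v k u)
↓v k (lam n p s) = lam n (↓v k p) (↓v (suc k) s)

-- substitution at a level: list of (j , u_j)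
DSubst : Set
DSubst = List (ℕ × DB)

dlookup : ℕ → DSubst → Maybe DB
dlookup k []            = nothing
dlookup k ((j , u) ∷ σ) = if k ≡ᵇ j then just u else dlookup k σ

mapD : (DB → DB) → DSubst → DSubst
mapD f = map (λ { (j , u) → (j , f u) })

dsubst : ℕ → DSubst → DB → DB
dsubst i σ (v i' k) with i' ≡ᵇ i | dlookup k σ
... | true | just u = u
... | _    | _      = v i' k
dsubst i σ (m i' k)    = m i' k
dsubst i σ (app t u)   = app (dsubst i σ t) (dsubst i σ u)
dsubst i σ (lam n p s) = lam n (dsubst i (mapD (↑m 0) σ) p) (dsubst (suc i) (mapD (↑v 0) σ) s)

ddom : DSubst → List ℕ
ddom = map (λ { (j , _) → j })

isDSd : DB → Bool
isDSd (m _ _)   = true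
isDSd (app d _) = isDSd d
isDSd _         = false

isMFd : DB → Bool
isMFd (lam _ _ _) = true
isMFd t           = isDSd t

_⊎D_ : Match DSubst → Match DSubst → Match DSubst
fail ⊎D _    = fail
_    ⊎D fail = fail
wait ⊎D _    = wait
_    ⊎D wait = wait
ok σ ⊎D ok τ = if disjointB (ddom σ) (ddom τ) then ok (σ ++ τ) else fail

dmatchRest : DB → DB → Match DSubst

dmatch₀ : DB → DB → Match DSubst
dmatch₀ (m 1 j) u = ok ((j , u) ∷ [])
dmatch₀ (m (suc (suc i)) j) (m i' j') =
  if (suc i ≡ᵇ i') ∧ (j ≡ᵇ j') then ok [] else dmatchRest (m (suc (suc i)) j) (m i' j')
dmatch₀ p u = dmatchRest p u

dmatchRest (app p q) (app t u) with isMFd (app p q) ∧ isMFd (app t u)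
... | true  = dmatch₀ p t ⊎D dmatch₀ q u
... | false = if isMFd (app p q) ∧ isMFd (app t u) then fail else wait
dmatchRest p u = if isMFd p ∧ isMFd u then fail else wait

oneTo : ℕ → List ℕ
oneTo zero    = []
oneTo (suc n) = oneTo n ++ (suc n ∷ [])

dmatch : ℕ → DB → DB → Match DSubst
dmatch n p u with dmatch₀ p u
... | ok σ = if sameSet (ddom σ) (oneTo n) then ok σ else fail
... | r    = r

data _⟶dBʳ_ : DB → DB → Set where
  β-ok   : ∀ {n p s u σ} → dmatch n p (↑v 0 u) ≡ ok σ →
           app (lam n p s) u ⟶dBʳ ↓v 0 (dsubst 1 σ s)
  β-fail : ∀ {n p s u} → dmatch n p (↑v 0 u) ≡ fail →
           app (lam n p s) u ⟶dBʳ ↓v 0 (lam 1 (m 1 1) (v 1 1))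
  ξ-appˡ : ∀ {t t' u} → t ⟶dBʳ t' → app t u ⟶dBʳ app t' u
  ξ-appʳ : ∀ {t u u'} → u ⟶dBʳ u' → app t u ⟶dBʳ app t u'
  ξ-pat  : ∀ {n p p' s} → p ⟶dBʳ p' → lam n p s ⟶dBʳ lam n p' s
  ξ-body : ∀ {n p s s'} → s ⟶dBʳ s' → lam n p s ⟶dBʳ lam n p s'

act : ∀ {n} → Permutation′ n → ℕ → ℕ
act π zero = zero
act {n} π (suc k) with k <? n
... | yes k<n = suc (toℕ (π ⟨$⟩ʳ fromℕ< k<n))
... | no  _   = suc k

permV : ℕ → (ℕ → ℕ) → DB → DB
permV k f (v i j)     = if i ≡ᵇ k then v i (f j) else v i j
permV k f (m i j)     = m i j
permV k f (app t u)   = app (permV k f t) (permV k f u)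
permV k f (lam n p s) = lam n (permV k f p) (permV (suc k) f s)

permM : ℕ → (ℕ → ℕ) → DB → DB
permM k f (v i j)     = v i j
permM k f (m i j)     = if i ≡ᵇ k then m i (f j) else m i j
permM k f (app t u)   = app (permM k f t) (permM k f u)
permM k f (lam n p s) = lam n (permM (suc k) f p) (permM k f s)

data _≈p_ : DB → DB → Set where
  p-refl  : ∀ {t} → t ≈p t
  p-sym   : ∀ {t u} → t ≈p u → u ≈p t
  p-trans : ∀ {t u w} → t ≈p u → u ≈p w → t ≈p w
  p-app   : ∀ {t t' u u'} → t ≈p t' → u ≈p u' → app t u ≈p app t' u'
  p-lam   : ∀ {n p p' s s'} → p ≈p p' → s ≈p s' → lam n p s ≈p lam n p' s'
  p-perm  : ∀ {n p s} (π : Permutation′ n) →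
            lam n p s ≈p lam n (permM 1 (act π) p) (permV 1 (act π) s)

_⟶dB_ : DB → DB → Set
a ⟶dB b = Σ DB λ a₁ → Σ DB λ b₁ → a ≈p a₁ × a₁ ⟶dBʳ b₁ × b₁ ≈p b

-- Translation T_{V,M}; undefined (nothing) when a free symbol is not found.

posIn : Sym → List Sym → Maybe ℕ   -- 1-based, first occurrence
posIn x []       = nothing
posIn x (y ∷ ys) = if x ≡ᵇ y then just 1 else Data.Maybe.map suc (posIn x ys)
  where import Data.Maybe

idx : Sym → List (List Sym) → Maybe (ℕ × ℕ)
idx x []       = nothing
idx x (θ ∷ V) with posIn x θ
... | just j  = just (1 , j)
... | nothing = Data.Maybe.map (λ { (i , j) → (suc i , j) }) (idx x V)
  where import Data.Maybe

T : List (List Sym) → List (List Sym) → Term → Maybe DB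
T V M (var x) with idx x V
... | just (i , j) = just (v i j)
... | nothing      = nothing
T V M (mat x) with idx x M
... | just (i , j) = just (m i j)
... | nothing      = nothing
T V M (app t u) with T V M t | T V M u
... | just a | just b = just (app a b)
... | _      | _      = nothing
T V M (lam θ p s) with T V (θ ∷ M) p | T (θ ∷ V) M s
... | just a | just b = just (lam (length θ) a b)
... | _      | _      = nothing

module Submission where

-- A PPC step is a raw step t₁ ⟶ʳ t₂ between α-representatives, so the proof
-- has two halves.  (1) α-invariance: T_{V,M} and binder uniqueness are
-- constant on α-classes, because renaming a bound symbol x to a fresh y puts
-- y at the position x had, so every index is unchanged.  (2) Raw simulation,
-- by induction on the raw step.  Congruence steps are immediate since T is
-- compositional.  For a redex (λ_θ p.s) u two facts are needed:
--   * matching commutes with translation: {p/u}_θ and {T p / ↑ T u}_{|θ|}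
--     both fail, both wait, or both succeed with substitutions related
--     entrywise (the symbol at position j of θ ↦ index j);
--   * the substitution lemma: translating σ s is substituting the translated
--     σ at the level of θ in the translated body,
-- both resting on weakening: translating under an extra layer of fresh
-- binders is the shift ↑ of the translation.

open import Defs
open import Data.Nat using (ℕ; zero; suc; _≡ᵇ_; _<ᵇ_; _<_; z≤n; s≤s)
open import Data.Nat.Properties using (m≤n⇒m<n∨m≡n; m<n⇒m<1+n; ≤-refl)
open import Data.Bool using (Bool; true; false; _∧_; _∨_; not; if_then_else_)
open import Data.Bool.Properties using (∨-conicalˡ; ∨-conicalʳ; ∨-identityʳ; ∧-conicalˡ; ∧-conicalʳ)
open import Data.List using (List; []; _∷_; _++_; map; length)
open import Data.List.Properties using (length-map)
open import Data.Maybe using (Maybe; just; nothing)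
import Data.Maybe as Maybe
open import Data.Product using (Σ; _×_; _,_)
open import Data.Sum using (_⊎_; inj₁; inj₂)
open import Data.Empty using (⊥; ⊥-elim)
open import Relation.Binary.PropositionalEquality
open import Data.List.Relation.Unary.All using (All; []; _∷_)
open import Data.List.Relation.Unary.Any using (Any; here; there)
open import Data.List.Relation.Unary.Unique.Propositional using (Unique)
open import Data.List.Relation.Unary.AllPairs using ([]; _∷_)
import Data.List.Relation.Unary.Unique.Propositional.Properties as Unique
open import Data.List.Relation.Binary.Pointwise using (Pointwise; []; _∷_; ++⁺)

true≢false : true ≡ false → ⊥
true≢false ()

≡ᵇ-sound : ∀ x y → (x ≡ᵇ y) ≡ true → x ≡ y
≡ᵇ-sound zero    zero    _ = refl
≡ᵇ-sound (suc x) (suc y) e = cong suc (≡ᵇ-sound x y e)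

≡ᵇ-refl : ∀ x → (x ≡ᵇ x) ≡ true
≡ᵇ-refl zero    = refl
≡ᵇ-refl (suc x) = ≡ᵇ-refl x

≢⇒≡ᵇ-false : ∀ x y → x ≢ y → (x ≡ᵇ y) ≡ false
≢⇒≡ᵇ-false x y x≢y with x ≡ᵇ y in e
... | true  = ⊥-elim (x≢y (≡ᵇ-sound x y e))
... | false = refl

≡ᵇ-false⇒≢ : ∀ x y → (x ≡ᵇ y) ≡ false → x ≢ y
≡ᵇ-false⇒≢ x .x e refl = true≢false (trans (sym (≡ᵇ-refl x)) e)

≡ᵇ-sym : ∀ x y → (x ≡ᵇ y) ≡ (y ≡ᵇ x)
≡ᵇ-sym zero    zero    = refl
≡ᵇ-sym zero    (suc y) = refl
≡ᵇ-sym (suc x) zero    = refl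
≡ᵇ-sym (suc x) (suc y) = ≡ᵇ-sym x y

∨-introˡ : ∀ a b → a ≡ true → (a ∨ b) ≡ true
∨-introˡ .true b refl = refl

∨-introʳ : ∀ a b → b ≡ true → (a ∨ b) ≡ true
∨-introʳ true  b _ = refl
∨-introʳ false b e = e

∨-elim : ∀ a b → (a ∨ b) ≡ true → (a ≡ true) ⊎ (b ≡ true)
∨-elim true  b _ = inj₁ refl
∨-elim false b e = inj₂ e

not-true : ∀ a → not a ≡ true → a ≡ false
not-true false _ = refl

bool-ext : ∀ a b → (a ≡ true → b ≡ true) → (b ≡ true → a ≡ true) → a ≡ b
bool-ext true  true  _ _ = refl
bool-ext false false _ _ = refl
bool-ext true  false f _ = sym (f refl)
bool-ext false true  _ g = g refl

elem-++ : ∀ x xs ys → elem x (xs ++ ys) ≡ (elem x xs ∨ elem x ys)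
elem-++ x []       ys = refl
elem-++ x (y ∷ xs) ys with x ≡ᵇ y
... | true  = refl
... | false = elem-++ x xs ys

elem-++ˡ : ∀ x xs ys → elem x xs ≡ true → elem x (xs ++ ys) ≡ true
elem-++ˡ x xs ys e rewrite elem-++ x xs ys = ∨-introˡ _ _ e

elem-++ʳ : ∀ x xs ys → elem x ys ≡ true → elem x (xs ++ ys) ≡ true
elem-++ʳ x xs ys e rewrite elem-++ x xs ys = ∨-introʳ _ _ e

allB-intro : ∀ (f : ℕ → Bool) xs → (∀ x → elem x xs ≡ true → f x ≡ true) → allB f xs ≡ true
allB-intro f []       h = refl
allB-intro f (a ∷ xs) h
  rewrite h a (∨-introˡ (a ≡ᵇ a) _ (≡ᵇ-refl a)) = allB-intro f xs (λ x e → h x (∨-introʳ (x ≡ᵇ a) _ e))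

allB-elim : ∀ (f : ℕ → Bool) xs x → allB f xs ≡ true → elem x xs ≡ true → f x ≡ true
allB-elim f (a ∷ xs) x h e with ∨-elim (x ≡ᵇ a) _ e
... | inj₁ x≡a rewrite ≡ᵇ-sound x a x≡a = ∧-conicalˡ (f a) _ h
... | inj₂ x∈xs = allB-elim f xs x (∧-conicalʳ (f a) _ h) x∈xs

All-elem : ∀ {P : ℕ → Set} xs y → All P xs → elem y xs ≡ true → P y
All-elem (a ∷ xs) y (pa ∷ ps) e with ∨-elim (y ≡ᵇ a) _ e
... | inj₁ y≡a rewrite ≡ᵇ-sound y a y≡a = pa
... | inj₂ y∈xs = All-elem xs y ps y∈xs

map-just-inv : ∀ {A B : Set} (f : A → B) (mx : Maybe A) b →
               Maybe.map f mx ≡ just b → Σ A λ a → mx ≡ just a × b ≡ f a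
map-just-inv f (just a) .(f a) refl = a , refl , refl

map-suc-inv : ∀ (mk : Maybe ℕ) j → Maybe.map suc mk ≡ just j → Σ ℕ λ k → mk ≡ just k × j ≡ suc k
map-suc-inv = map-just-inv suc

posIn-range : ∀ x θ k → posIn x θ ≡ just k → Σ ℕ λ k' → k ≡ suc k' × k' < length θ
posIn-range x (a ∷ θ) k e with x ≡ᵇ a
posIn-range x (a ∷ θ) .1 refl | true = 0 , refl , s≤s z≤n
... | false with map-suc-inv (posIn x θ) k e
... | k₀ , e₀ , refl with posIn-range x θ k₀ e₀
... | k₀' , refl , lt = suc k₀' , refl , s≤s lt

posIn≢0 : ∀ x θ → posIn x θ ≡ just 0 → ⊥
posIn≢0 x θ e with posIn-range x θ 0 e
... | _ , () , _

posIn-head : ∀ a θ → posIn a (a ∷ θ) ≡ just 1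
posIn-head a θ rewrite ≡ᵇ-refl a = refl

posIn-elem : ∀ x θ j → posIn x θ ≡ just j → elem x θ ≡ true
posIn-elem x (a ∷ θ) j e with x ≡ᵇ a
... | true  = refl
... | false with map-suc-inv (posIn x θ) j e
... | k , e₁ , _ = posIn-elem x θ k e₁

elem-posIn : ∀ x θ → elem x θ ≡ true → Σ ℕ λ j → posIn x θ ≡ just j
elem-posIn x (a ∷ θ) e with x ≡ᵇ a
... | true  = 1 , refl
... | false with elem-posIn x θ e
... | j , e₁ rewrite e₁ = suc j , refl

posIn-nothing : ∀ x θ → elem x θ ≡ false → posIn x θ ≡ nothing
posIn-nothing x []      _ = refl
posIn-nothing x (a ∷ θ) e with x ≡ᵇ a
... | false rewrite posIn-nothing x θ e = refl

posIn-nothing⁻ : ∀ x θ → posIn x θ ≡ nothing → elem x θ ≡ false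
posIn-nothing⁻ x θ e with elem x θ in x∈θ
... | false = refl
... | true with elem-posIn x θ x∈θ
... | j , e₁ with trans (sym e) e₁
... | ()

posIn-inj : ∀ x y θ j → posIn x θ ≡ just j → posIn y θ ≡ just j → x ≡ y
posIn-inj x y (a ∷ θ) j ex ey with x ≡ᵇ a in xa | y ≡ᵇ a in ya
... | true  | true  = trans (≡ᵇ-sound x a xa) (sym (≡ᵇ-sound y a ya))
... | true  | false with map-suc-inv (posIn y θ) j ey | ex
...   | k , ek , refl | refl = ⊥-elim (posIn≢0 y θ ek)
posIn-inj x y (a ∷ θ) j ex ey | false | true with map-suc-inv (posIn x θ) j ex | ey
...   | k , ek , refl | refl = ⊥-elim (posIn≢0 x θ ek)
posIn-inj x y (a ∷ θ) j ex ey | false | false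
  with map-suc-inv (posIn x θ) j ex | map-suc-inv (posIn y θ) j ey
... | k , ex' , refl | .k , ey' , refl = posIn-inj x y θ k ex' ey'

posIn-≡ᵇ : ∀ x y θ j j' → posIn x θ ≡ just j → posIn y θ ≡ just j' → (x ≡ᵇ y) ≡ (j ≡ᵇ j')
posIn-≡ᵇ x y θ j j' ex ey =
  bool-ext _ _ (λ e → same-pos (≡ᵇ-sound x y e)) (λ e → same-sym (≡ᵇ-sound j j' e))
  where
  same-pos : x ≡ y → (j ≡ᵇ j') ≡ true
  same-pos refl with trans (sym ex) ey
  ... | refl = ≡ᵇ-refl j
  same-sym : j ≡ j' → (x ≡ᵇ y) ≡ true
  same-sym refl with posIn-inj x y θ j ex ey
  ... | refl = ≡ᵇ-refl x

unique-pos : ∀ θ k → Unique θ → k < length θ → Σ Sym λ y → posIn y θ ≡ just (suc k)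
unique-pos (a ∷ θ) zero    _         _        = a , posIn-head a θ
unique-pos (a ∷ θ) (suc k) (a∉ ∷ uθ) (s≤s lt) with unique-pos θ k uθ lt
... | y , e = y , at-suc
  where
  at-suc : posIn y (a ∷ θ) ≡ just (suc (suc k))
  at-suc rewrite ≢⇒≡ᵇ-false y a (λ y≡a → All-elem θ y a∉ (posIn-elem y θ _ e) (sym y≡a)) | e = refl

oneTo-intro : ∀ n k → k < n → elem (suc k) (oneTo n) ≡ true
oneTo-intro (suc n) k (s≤s k≤n) with m≤n⇒m<n∨m≡n k≤n
... | inj₁ k<n  = elem-++ˡ (suc k) (oneTo n) _ (oneTo-intro n k k<n)
... | inj₂ refl = elem-++ʳ (suc k) (oneTo k) _ (∨-introˡ (suc k ≡ᵇ suc k) false (≡ᵇ-refl k))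

oneTo-elim : ∀ n k → elem k (oneTo n) ≡ true → Σ ℕ λ k' → k ≡ suc k' × k' < n
oneTo-elim (suc n) k e rewrite elem-++ k (oneTo n) (suc n ∷ []) with ∨-elim (elem k (oneTo n)) _ e
... | inj₁ e₁ with oneTo-elim n k e₁
...   | k' , refl , lt = k' , refl , m<n⇒m<1+n lt
oneTo-elim (suc n) k e | inj₂ e₂ with ≡ᵇ-sound k (suc n) (trans (sym (∨-identityʳ (k ≡ᵇ suc n))) e₂)
... | refl = n , refl , ≤-refl

-- Indices in a context.  idx x C = (i , j) says x is found first in the
-- i-th layer of C, at position j; the layer index i is always ≥ 1.

incr : ℕ × ℕ → ℕ × ℕ
incr (i , j) = (suc i , j)

idx-cons-just : ∀ x θ C j → posIn x θ ≡ just j → idx x (θ ∷ C) ≡ just (1 , j)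
idx-cons-just x θ C j e rewrite e = refl

idx-cons-nothing : ∀ x θ C → posIn x θ ≡ nothing → idx x (θ ∷ C) ≡ Maybe.map incr (idx x C)
idx-cons-nothing x θ C e rewrite e with idx x C
... | just _  = refl
... | nothing = refl

idx-view : ∀ x θ C → (Σ ℕ λ j → posIn x θ ≡ just j × idx x (θ ∷ C) ≡ just (1 , j))
                   ⊎ (posIn x θ ≡ nothing × idx x (θ ∷ C) ≡ Maybe.map incr (idx x C))
idx-view x θ C with posIn x θ
... | just j  = inj₁ (j , refl , refl)
... | nothing with idx x C
...   | just _  = inj₂ (refl , refl)
...   | nothing = inj₂ (refl , refl)

map-incr-inv : ∀ (mp : Maybe (ℕ × ℕ)) i j → Maybe.map incr mp ≡ just (i , j) →
               Σ ℕ λ i' → i ≡ suc i' × mp ≡ just (i' , j)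
map-incr-inv (just (i' , j')) .(suc i') .j' refl = i' , refl , refl

idx-layer-pos : ∀ x C i j → idx x C ≡ just (i , j) → Σ ℕ λ i' → i ≡ suc i'
idx-layer-pos x (θ ∷ C) i j e with idx-view x θ C
... | inj₁ (j' , _ , e₁) with trans (sym e) e₁
...   | refl = 0 , refl
idx-layer-pos x (θ ∷ C) i j e | inj₂ (_ , e₁) with map-incr-inv (idx x C) i j (trans (sym e₁) e)
...   | i' , refl , _ = i' , refl

idx-layer≢0 : ∀ x C j → idx x C ≡ just (0 , j) → ⊥
idx-layer≢0 x C j e with idx-layer-pos x C 0 j e
... | _ , ()

idx-inj : ∀ x y C i j → idx x C ≡ just (i , j) → idx y C ≡ just (i , j) → x ≡ y
idx-inj x y (θ ∷ C) i j ex ey with idx-view x θ C | idx-view y θ C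
... | inj₁ (_ , px , ex') | inj₁ (_ , py , ey') with trans (sym ex) ex' | trans (sym ey) ey'
...   | refl | refl = posIn-inj x y θ j px py
idx-inj x y (θ ∷ C) i j ex ey | inj₁ (_ , _ , ex') | inj₂ (_ , ey') with trans (sym ex) ex'
... | refl with map-incr-inv (idx y C) 1 j (trans (sym ey') ey)
...   | .0 , refl , ey'' = ⊥-elim (idx-layer≢0 y C j ey'')
idx-inj x y (θ ∷ C) i j ex ey | inj₂ (_ , ex') | inj₁ (_ , _ , ey') with trans (sym ey) ey'
... | refl with map-incr-inv (idx x C) 1 j (trans (sym ex') ex)
...   | .0 , refl , ex'' = ⊥-elim (idx-layer≢0 x C j ex'')
idx-inj x y (θ ∷ C) i j ex ey | inj₂ (_ , ex') | inj₂ (_ , ey')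
  with map-incr-inv (idx x C) i j (trans (sym ex') ex) | map-incr-inv (idx y C) i j (trans (sym ey') ey)
... | i' , refl , ex'' | .i' , refl , ey'' = idx-inj x y C i' j ex'' ey''

idx-≡ᵇ : ∀ x y C i j i' j' → idx x C ≡ just (i , j) → idx y C ≡ just (i' , j') →
         (x ≡ᵇ y) ≡ ((i ≡ᵇ i') ∧ (j ≡ᵇ j'))
idx-≡ᵇ x y C i j i' j' ex ey = bool-ext _ _ same-idx same-sym
  where
  same-idx : (x ≡ᵇ y) ≡ true → ((i ≡ᵇ i') ∧ (j ≡ᵇ j')) ≡ true
  same-idx e with ≡ᵇ-sound x y e
  ... | refl with trans (sym ex) ey
  ...   | refl rewrite ≡ᵇ-refl i | ≡ᵇ-refl j = refl
  same-sym : ((i ≡ᵇ i') ∧ (j ≡ᵇ j')) ≡ true → (x ≡ᵇ y) ≡ true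
  same-sym e with ≡ᵇ-sound i i' (∧-conicalˡ _ _ e) | ≡ᵇ-sound j j' (∧-conicalʳ (i ≡ᵇ i') _ e)
  ... | refl | refl with idx-inj x y C i j ex ey
  ...   | refl = ≡ᵇ-refl x

idx-cong-tail : ∀ z θ C C' → idx z C ≡ idx z C' → idx z (θ ∷ C) ≡ idx z (θ ∷ C')
idx-cong-tail z θ C C' e with posIn z θ
... | just j  = refl
... | nothing rewrite e = refl

idx-cong-head : ∀ z θ₁ θ₂ C → posIn z θ₁ ≡ posIn z θ₂ → idx z (θ₁ ∷ C) ≡ idx z (θ₂ ∷ C)
idx-cong-head z θ₁ θ₂ C e rewrite e = refl

shiftPair : ℕ → ℕ × ℕ → ℕ × ℕ
shiftPair k (i , j) = ((if k <ᵇ i then suc i else i) , j)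

idx-insert : ∀ x C₁ θ' C₂ → elem x θ' ≡ false →
             idx x (C₁ ++ θ' ∷ C₂) ≡ Maybe.map (shiftPair (length C₁)) (idx x (C₁ ++ C₂))
idx-insert x [] θ' C₂ x∉θ' rewrite idx-cons-nothing x θ' C₂ (posIn-nothing x θ' x∉θ') with idx x C₂ in e
... | nothing      = refl
... | just (i , j) with idx-layer-pos x C₂ i j e
...   | i' , refl = refl
idx-insert x (θ ∷ C₁) θ' C₂ x∉θ' with idx-view x θ (C₁ ++ θ' ∷ C₂) | idx-view x θ (C₁ ++ C₂)
... | inj₁ (j , e₁ , e₂) | inj₁ (j' , e₁' , e₂') with trans (sym e₁) e₁'
...   | refl rewrite e₂ | e₂' = refl
idx-insert x (θ ∷ C₁) θ' C₂ x∉θ' | inj₁ (_ , e₁ , _) | inj₂ (e₁' , _) with trans (sym e₁) e₁'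
... | ()
idx-insert x (θ ∷ C₁) θ' C₂ x∉θ' | inj₂ (e₁ , _) | inj₁ (_ , e₁' , _) with trans (sym e₁) e₁'
... | ()
idx-insert x (θ ∷ C₁) θ' C₂ x∉θ' | inj₂ (_ , e₂) | inj₂ (_ , e₂')
  rewrite e₂ | e₂' | idx-insert x C₁ θ' C₂ x∉θ' with idx x (C₁ ++ C₂)
... | nothing      = refl
... | just (i , j) with length C₁ <ᵇ i
...   | true  = refl
...   | false = refl

idx-shadow : ∀ x C₁ θ₁ θ₂ C → Any (λ l → elem x l ≡ true) C₁ →
             idx x (C₁ ++ θ₁ ∷ C) ≡ idx x (C₁ ++ θ₂ ∷ C)
idx-shadow x (l ∷ C₁) θ₁ θ₂ C (here x∈l) with elem-posIn x l x∈l
... | j , e = trans (idx-cons-just x l _ j e) (sym (idx-cons-just x l _ j e))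
idx-shadow x (l ∷ C₁) θ₁ θ₂ C (there h) = idx-cong-tail x l _ _ (idx-shadow x C₁ θ₁ θ₂ C h)

idx-empty-layer : ∀ x C₁ θ C i j → idx x (C₁ ++ θ ∷ C) ≡ just (i , j) → i ≢ suc (length C₁) →
                  idx x (C₁ ++ [] ∷ C) ≡ just (i , j)
idx-empty-layer x [] θ C i j e i≢1 with idx-view x θ C
... | inj₁ (_ , _ , e₂) with trans (sym e) e₂
...   | refl = ⊥-elim (i≢1 refl)
idx-empty-layer x [] θ C i j e i≢1 | inj₂ (_ , e₂) = trans (idx-cons-nothing x [] C refl) (trans (sym e₂) e)
idx-empty-layer x (l ∷ C₁) θ C i j e i≢ with idx-view x l (C₁ ++ θ ∷ C)
... | inj₁ (j' , e₁ , e₂) with trans (sym e) e₂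
...   | refl = idx-cons-just x l _ j' e₁
idx-empty-layer x (l ∷ C₁) θ C i j e i≢ | inj₂ (e₁ , e₂)
  with map-incr-inv (idx x (C₁ ++ θ ∷ C)) i j (trans (sym e₂) e)
... | i' , refl , e₃ =
  trans (idx-cons-nothing x l _ e₁)
        (cong (Maybe.map incr) (idx-empty-layer x C₁ θ C i' j e₃ (λ q → i≢ (cong suc q))))

-- Structural equations for the translation.  T is defined by with-clauses;
-- these equations expose it as a compositional function on Maybe, through
-- the strict binary combination `comb`.

vmk : ℕ × ℕ → DB
vmk (i , j) = v i j

mmk : ℕ × ℕ → DB
mmk (i , j) = m i j

comb : (DB → DB → DB) → Maybe DB → Maybe DB → Maybe DB
comb f (just a) (just b) = just (f a b)
comb f (just a) nothing  = nothing
comb f nothing  _        = nothing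

T-var : ∀ V M x → T V M (var x) ≡ Maybe.map vmk (idx x V)
T-var V M x with idx x V
... | just (i , j) = refl
... | nothing      = refl

T-mat : ∀ V M x → T V M (mat x) ≡ Maybe.map mmk (idx x M)
T-mat V M x with idx x M
... | just (i , j) = refl
... | nothing      = refl

T-app : ∀ V M t u → T V M (app t u) ≡ comb app (T V M t) (T V M u)
T-app V M t u with T V M t | T V M u
... | just a  | just b  = refl
... | just a  | nothing = refl
... | nothing | _       = refl

T-lam : ∀ V M θ p s → T V M (lam θ p s) ≡ comb (lam (length θ)) (T V (θ ∷ M) p) (T (θ ∷ V) M s)
T-lam V M θ p s with T V (θ ∷ M) p | T (θ ∷ V) M s
... | just a  | just b  = refl
... | just a  | nothing = refl
... | nothing | _       = refl

comb-inv : ∀ g A B c → comb g A B ≡ just c →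
           Σ DB λ a → Σ DB λ b → A ≡ just a × B ≡ just b × c ≡ g a b
comb-inv g (just a) (just b) .(g a b) refl = a , b , refl , refl , refl

comb-map : ∀ (h f₁ f₂ : DB → DB) g g' A B → (∀ a b → h (g a b) ≡ g' (f₁ a) (f₂ b)) →
           Maybe.map h (comb g A B) ≡ comb g' (Maybe.map f₁ A) (Maybe.map f₂ B)
comb-map h f₁ f₂ g g' (just a) (just b) e = cong just (e a b)
comb-map h f₁ f₂ g g' (just a) nothing  e = refl
comb-map h f₁ f₂ g g' nothing  B        e = refl

T-app-inv : ∀ V M t u c → T V M (app t u) ≡ just c →
            Σ DB λ a → Σ DB λ b → T V M t ≡ just a × T V M u ≡ just b × c ≡ app a b
T-app-inv V M t u c e = comb-inv app _ _ c (trans (sym (T-app V M t u)) e)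

T-lam-inv : ∀ V M θ p s c → T V M (lam θ p s) ≡ just c →
            Σ DB λ a → Σ DB λ b → T V (θ ∷ M) p ≡ just a × T (θ ∷ V) M s ≡ just b × c ≡ lam (length θ) a b
T-lam-inv V M θ p s c e = comb-inv (lam (length θ)) _ _ c (trans (sym (T-lam V M θ p s)) e)

T-app-just : ∀ V M t u a b → T V M t ≡ just a → T V M u ≡ just b → T V M (app t u) ≡ just (app a b)
T-app-just V M t u a b e₁ e₂ = trans (T-app V M t u) (cong₂ (comb app) e₁ e₂)

T-lam-just : ∀ V M θ p s a b → T V (θ ∷ M) p ≡ just a → T (θ ∷ V) M s ≡ just b →
             T V M (lam θ p s) ≡ just (lam (length θ) a b)
T-lam-just V M θ p s a b e₁ e₂ = trans (T-lam V M θ p s) (cong₂ (comb (lam (length θ))) e₁ e₂)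

data SameShape : Term → DB → Set where
  var : ∀ {x i j}       → SameShape (var x) (v i j)
  mat : ∀ {x i j}       → SameShape (mat x) (m i j)
  app : ∀ {t u a b}     → SameShape (app t u) (app a b)
  lam : ∀ {θ p s n a b} → SameShape (lam θ p s) (lam n a b)

T-shape : ∀ V M t a → T V M t ≡ just a → SameShape t a
T-shape V M (var x) a e with map-just-inv vmk (idx x V) a (trans (sym (T-var V M x)) e)
... | (i , j) , _ , refl = var
T-shape V M (mat x) a e with map-just-inv mmk (idx x M) a (trans (sym (T-mat V M x)) e)
... | (i , j) , _ , refl = mat
T-shape V M (app t u) c e with T-app-inv V M t u c e
... | _ , _ , _ , _ , refl = app
T-shape V M (lam θ p s) c e with T-lam-inv V M θ p s c e
... | _ , _ , _ , _ , refl = lam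

isDS-T : ∀ V M t a → T V M t ≡ just a → isDS t ≡ isDSd a
isDS-T V M t a e with T-shape V M t a e
isDS-T V M (var x)     (v i j)     e | var = refl
isDS-T V M (mat x)     (m i j)     e | mat = refl
isDS-T V M (app t u)   (app a b)   e | app with T-app-inv V M t u _ e
... | _ , _ , ea , _ , refl = isDS-T V M t a ea
isDS-T V M (lam θ p s) (lam n a b) e | lam = refl

isMF-T : ∀ V M t a → T V M t ≡ just a → isMF t ≡ isMFd a
isMF-T V M t a e with T-shape V M t a e
isMF-T V M (var x)     (v i j)     e | var = refl
isMF-T V M (mat x)     (m i j)     e | mat = refl
isMF-T V M (app t u)   (app a b)   e | app = isDS-T V M (app t u) (app a b) e
isMF-T V M (lam θ p s) (lam n a b) e | lam = refl

Fresh : List Sym → Term → Set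
Fresh θ u = ∀ z → elem z θ ≡ true → occurs z u ≡ false

fresh-var : ∀ θ x → Fresh θ (var x) → elem x θ ≡ false
fresh-var θ x h with elem x θ in x∈θ
... | true  = ⊥-elim (true≢false (trans (sym (≡ᵇ-refl x)) (h x x∈θ)))
... | false = refl

fresh-appˡ : ∀ θ t u → Fresh θ (app t u) → Fresh θ t
fresh-appˡ θ t u h z e = ∨-conicalˡ _ _ (h z e)

fresh-appʳ : ∀ θ t u → Fresh θ (app t u) → Fresh θ u
fresh-appʳ θ t u h z e = ∨-conicalʳ _ _ (h z e)

fresh-pat : ∀ θ θ₁ p s → Fresh θ (lam θ₁ p s) → Fresh θ p
fresh-pat θ θ₁ p s h z e = ∨-conicalˡ (occurs z p) (occurs z s) (∨-conicalʳ (elem z θ₁) _ (h z e))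

fresh-body : ∀ θ θ₁ p s → Fresh θ (lam θ₁ p s) → Fresh θ s
fresh-body θ θ₁ p s h z e = ∨-conicalʳ (occurs z p) (occurs z s) (∨-conicalʳ (elem z θ₁) _ (h z e))

fresh-[] : ∀ u → Fresh [] u
fresh-[] u z ()

fresh-++ˡ : ∀ xs ys u → Fresh (xs ++ ys) u → Fresh xs u
fresh-++ˡ xs ys u h z e = h z (elem-++ˡ z xs ys e)

fresh-++ʳ : ∀ xs ys u → Fresh (xs ++ ys) u → Fresh ys u
fresh-++ʳ xs ys u h z e = h z (elem-++ʳ z xs ys e)

↑v-vmk : ∀ k p → ↑v k (vmk p) ≡ vmk (shiftPair k p)
↑v-vmk k (i , j) with k <ᵇ i
... | true  = refl
... | false = refl

↑m-mmk : ∀ k p → ↑m k (mmk p) ≡ mmk (shiftPair k p)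
↑m-mmk k (i , j) with k <ᵇ i
... | true  = refl
... | false = refl

weaken-V : ∀ u C₁ θ' C₂ M → Fresh θ' u →
           T (C₁ ++ θ' ∷ C₂) M u ≡ Maybe.map (↑v (length C₁)) (T (C₁ ++ C₂) M u)
weaken-V (var x) C₁ θ' C₂ M h
  rewrite T-var (C₁ ++ θ' ∷ C₂) M x | T-var (C₁ ++ C₂) M x | idx-insert x C₁ θ' C₂ (fresh-var θ' x h)
  with idx x (C₁ ++ C₂)
... | just p  = cong just (sym (↑v-vmk (length C₁) p))
... | nothing = refl
weaken-V (mat x) C₁ θ' C₂ M h rewrite T-mat (C₁ ++ θ' ∷ C₂) M x | T-mat (C₁ ++ C₂) M x with idx x M
... | just p  = refl
... | nothing = refl
weaken-V (app t u) C₁ θ' C₂ M h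
  rewrite T-app (C₁ ++ θ' ∷ C₂) M t u | T-app (C₁ ++ C₂) M t u
        | weaken-V t C₁ θ' C₂ M (fresh-appˡ θ' t u h) | weaken-V u C₁ θ' C₂ M (fresh-appʳ θ' t u h) =
  sym (comb-map (↑v k) (↑v k) (↑v k) app app (T (C₁ ++ C₂) M t) (T (C₁ ++ C₂) M u) (λ _ _ → refl))
  where k = length C₁
weaken-V (lam θ p s) C₁ θ' C₂ M h
  rewrite T-lam (C₁ ++ θ' ∷ C₂) M θ p s | T-lam (C₁ ++ C₂) M θ p s
        | weaken-V p C₁ θ' C₂ (θ ∷ M) (fresh-pat θ' θ p s h) | weaken-V s (θ ∷ C₁) θ' C₂ M (fresh-body θ' θ p s h) =
  sym (comb-map (↑v k) (↑v k) (↑v (suc k)) (lam (length θ)) (lam (length θ))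
                (T (C₁ ++ C₂) (θ ∷ M) p) (T (θ ∷ C₁ ++ C₂) M s) (λ _ _ → refl))
  where k = length C₁

weaken-M : ∀ u V C₁ θ' C₂ → Fresh θ' u →
           T V (C₁ ++ θ' ∷ C₂) u ≡ Maybe.map (↑m (length C₁)) (T V (C₁ ++ C₂) u)
weaken-M (var x) V C₁ θ' C₂ h rewrite T-var V (C₁ ++ θ' ∷ C₂) x | T-var V (C₁ ++ C₂) x with idx x V
... | just p  = refl
... | nothing = refl
weaken-M (mat x) V C₁ θ' C₂ h
  rewrite T-mat V (C₁ ++ θ' ∷ C₂) x | T-mat V (C₁ ++ C₂) x | idx-insert x C₁ θ' C₂ (fresh-var θ' x h)
  with idx x (C₁ ++ C₂)
... | just p  = cong just (sym (↑m-mmk (length C₁) p))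
... | nothing = refl
weaken-M (app t u) V C₁ θ' C₂ h
  rewrite T-app V (C₁ ++ θ' ∷ C₂) t u | T-app V (C₁ ++ C₂) t u
        | weaken-M t V C₁ θ' C₂ (fresh-appˡ θ' t u h) | weaken-M u V C₁ θ' C₂ (fresh-appʳ θ' t u h) =
  sym (comb-map (↑m k) (↑m k) (↑m k) app app (T V (C₁ ++ C₂) t) (T V (C₁ ++ C₂) u) (λ _ _ → refl))
  where k = length C₁
weaken-M (lam θ p s) V C₁ θ' C₂ h
  rewrite T-lam V (C₁ ++ θ' ∷ C₂) θ p s | T-lam V (C₁ ++ C₂) θ p s
        | weaken-M p V (θ ∷ C₁) θ' C₂ (fresh-pat θ' θ p s h) | weaken-M s (θ ∷ V) C₁ θ' C₂ (fresh-body θ' θ p s h) =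
  sym (comb-map (↑m k) (↑m (suc k)) (↑m k) (lam (length θ)) (lam (length θ))
                (T V (θ ∷ C₁ ++ C₂) p) (T (θ ∷ V) (C₁ ++ C₂) s) (λ _ _ → refl))
  where k = length C₁

<ᵇ-suc : ∀ k i → (k <ᵇ i) ≡ true → (k <ᵇ suc i) ≡ true
<ᵇ-suc zero    i       _ = refl
<ᵇ-suc (suc k) (suc i) e = <ᵇ-suc k i e

-- ↓ undoes ↑; the dB β-rule shifts the argument up and the contractum down.
↓v-↑v : ∀ k a → ↓v k (↑v k a) ≡ a
↓v-↑v k (v i j) with k <ᵇ i in e
... | true  rewrite <ᵇ-suc k i e = refl
... | false rewrite e = refl
↓v-↑v k (m i j)     = refl
↓v-↑v k (app a b)   = cong₂ app (↓v-↑v k a) (↓v-↑v k b)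
↓v-↑v k (lam n p s) = cong₂ (lam n) (↓v-↑v k p) (↓v-↑v (suc k) s)

-- Renaming a bound symbol x of θ to a symbol y occurring
-- nowhere in λ_θ p.s does not change the translation: y takes the position
-- of x in the renamed binder list, so every occurrence of x̂ (in p) or x (in
-- s) bound by this abstraction receives the same index as before, and all
-- other symbols keep theirs.
module Renaming (x y : Sym) (θ : List Sym) (x∈θ : elem x θ ≡ true) (y∉θ : elem y θ ≡ false) where

  rn : Sym → Sym
  rn = rnSym x y

  θ' : List Sym
  θ' = map rn θ

  posIn-other : ∀ z θ₀ → z ≢ x → z ≢ y → posIn z (map rn θ₀) ≡ posIn z θ₀
  posIn-other z []       z≢x z≢y = refl
  posIn-other z (a ∷ θ₀) z≢x z≢y with a ≡ᵇ x in a≡x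
  ... | true rewrite ≢⇒≡ᵇ-false z y z≢y | ≡ᵇ-sound a x a≡x | ≢⇒≡ᵇ-false z x z≢x =
    cong (Maybe.map suc) (posIn-other z θ₀ z≢x z≢y)
  ... | false with z ≡ᵇ a
  ...   | true  = refl
  ...   | false = cong (Maybe.map suc) (posIn-other z θ₀ z≢x z≢y)

  posIn-renamed : ∀ θ₀ → elem y θ₀ ≡ false → posIn y (map rn θ₀) ≡ posIn x θ₀
  posIn-renamed []       _ = refl
  posIn-renamed (a ∷ θ₀) h with a ≡ᵇ x in a≡x
  ... | true  rewrite ≡ᵇ-refl y | ≡ᵇ-sym x a | a≡x = refl
  ... | false rewrite ≡ᵇ-sym x a | a≡x | ∨-conicalˡ (y ≡ᵇ a) _ h =
    cong (Maybe.map suc) (posIn-renamed θ₀ (∨-conicalʳ (y ≡ᵇ a) _ h))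

  idx-other : ∀ z C₁ C → z ≢ x → z ≢ y → idx z (C₁ ++ θ ∷ C) ≡ idx z (C₁ ++ θ' ∷ C)
  idx-other z []       C z≢x z≢y = idx-cong-head z θ θ' C (sym (posIn-other z θ z≢x z≢y))
  idx-other z (l ∷ C₁) C z≢x z≢y = idx-cong-tail z l _ _ (idx-other z C₁ C z≢x z≢y)

  idx-renamed : ∀ C₁ C → All (λ l → elem x l ≡ false) C₁ → All (λ l → elem y l ≡ false) C₁ →
                idx x (C₁ ++ θ ∷ C) ≡ idx y (C₁ ++ θ' ∷ C)
  idx-renamed [] C [] [] with elem-posIn x θ x∈θ
  ... | j , e = trans (idx-cons-just x θ C j e) (sym (idx-cons-just y θ' C j (trans (posIn-renamed θ y∉θ) e)))
  idx-renamed (l ∷ C₁) C (x∉l ∷ x∉C₁) (y∉l ∷ y∉C₁) =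
    trans (idx-cons-nothing x l _ (posIn-nothing x l x∉l))
          (trans (cong (Maybe.map incr) (idx-renamed C₁ C x∉C₁ y∉C₁))
                 (sym (idx-cons-nothing y l _ (posIn-nothing y l y∉l))))

  y≢ : ∀ z → (y ≡ᵇ z) ≡ false → z ≢ y
  y≢ z e z≡y = ≡ᵇ-false⇒≢ y z e (sym z≡y)

  y∉lam : ∀ θ₁ p s → occurs y (lam θ₁ p s) ≡ false →
          (elem y θ₁ ≡ false) × (occurs y p ≡ false) × (occurs y s ≡ false)
  y∉lam θ₁ p s h = ∨-conicalˡ (elem y θ₁) _ h
                 , ∨-conicalˡ (occurs y p) (occurs y s) (∨-conicalʳ (elem y θ₁) _ h)
                 , ∨-conicalʳ (occurs y p) (occurs y s) (∨-conicalʳ (elem y θ₁) _ h)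

  -- Under an inner binder of x̂ the renaming stops, and the layer being
  -- renamed is invisible to x̂ anyway.
  T-renM-shadowed : ∀ p V M₁ M → occurs y p ≡ false → Any (λ l → elem x l ≡ true) M₁ →
                    T V (M₁ ++ θ ∷ M) p ≡ T V (M₁ ++ θ' ∷ M) p
  T-renM-shadowed (var z) V M₁ M y∉ sh = refl
  T-renM-shadowed (mat z) V M₁ M y∉ sh rewrite T-mat V (M₁ ++ θ ∷ M) z | T-mat V (M₁ ++ θ' ∷ M) z with z ≡ᵇ x in z≡x
  ... | true  rewrite ≡ᵇ-sound z x z≡x = cong (Maybe.map mmk) (idx-shadow x M₁ θ θ' M sh)
  ... | false = cong (Maybe.map mmk) (idx-other z M₁ M (≡ᵇ-false⇒≢ z x z≡x) (y≢ z y∉))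
  T-renM-shadowed (app t u) V M₁ M y∉ sh rewrite T-app V (M₁ ++ θ ∷ M) t u | T-app V (M₁ ++ θ' ∷ M) t u =
    cong₂ (comb app) (T-renM-shadowed t V M₁ M (∨-conicalˡ (occurs y t) (occurs y u) y∉) sh)
                     (T-renM-shadowed u V M₁ M (∨-conicalʳ (occurs y t) _ y∉) sh)
  T-renM-shadowed (lam θ₁ p s) V M₁ M y∉ sh with y∉lam θ₁ p s y∉
  ... | _ , y∉p , y∉s rewrite T-lam V (M₁ ++ θ ∷ M) θ₁ p s | T-lam V (M₁ ++ θ' ∷ M) θ₁ p s =
    cong₂ (comb (lam (length θ₁))) (T-renM-shadowed p V (θ₁ ∷ M₁) M y∉p (there sh))
                                   (T-renM-shadowed s (θ₁ ∷ V) M₁ M y∉s sh)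

  T-renM : ∀ p V M₁ M → occurs y p ≡ false →
           All (λ l → elem x l ≡ false) M₁ → All (λ l → elem y l ≡ false) M₁ →
           T V (M₁ ++ θ ∷ M) p ≡ T V (M₁ ++ θ' ∷ M) (renM x y p)
  T-renM (var z) V M₁ M y∉ x∉M₁ y∉M₁ = refl
  T-renM (mat z) V M₁ M y∉ x∉M₁ y∉M₁ with z ≡ᵇ x in z≡x
  ... | true  rewrite ≡ᵇ-sound z x z≡x | T-mat V (M₁ ++ θ ∷ M) x | T-mat V (M₁ ++ θ' ∷ M) y =
    cong (Maybe.map mmk) (idx-renamed M₁ M x∉M₁ y∉M₁)
  ... | false rewrite T-mat V (M₁ ++ θ ∷ M) z | T-mat V (M₁ ++ θ' ∷ M) z =
    cong (Maybe.map mmk) (idx-other z M₁ M (≡ᵇ-false⇒≢ z x z≡x) (y≢ z y∉))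
  T-renM (app t u) V M₁ M y∉ x∉M₁ y∉M₁
    rewrite T-app V (M₁ ++ θ ∷ M) t u | T-app V (M₁ ++ θ' ∷ M) (renM x y t) (renM x y u) =
    cong₂ (comb app) (T-renM t V M₁ M (∨-conicalˡ (occurs y t) (occurs y u) y∉) x∉M₁ y∉M₁)
                     (T-renM u V M₁ M (∨-conicalʳ (occurs y t) _ y∉) x∉M₁ y∉M₁)
  T-renM (lam θ₁ p s) V M₁ M y∉ x∉M₁ y∉M₁ with y∉lam θ₁ p s y∉ | elem x θ₁ in x∈θ₁
  ... | _ , y∉p , y∉s | true
    rewrite T-lam V (M₁ ++ θ ∷ M) θ₁ p s | T-lam V (M₁ ++ θ' ∷ M) θ₁ p (renM x y s) =
    cong₂ (comb (lam (length θ₁))) (T-renM-shadowed p V (θ₁ ∷ M₁) M y∉p (here x∈θ₁))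
                                   (T-renM s (θ₁ ∷ V) M₁ M y∉s x∉M₁ y∉M₁)
  ... | y∉θ₁ , y∉p , y∉s | false
    rewrite T-lam V (M₁ ++ θ ∷ M) θ₁ p s | T-lam V (M₁ ++ θ' ∷ M) θ₁ (renM x y p) (renM x y s) =
    cong₂ (comb (lam (length θ₁))) (T-renM p V (θ₁ ∷ M₁) M y∉p (x∈θ₁ ∷ x∉M₁) (y∉θ₁ ∷ y∉M₁))
                                   (T-renM s (θ₁ ∷ V) M₁ M y∉s x∉M₁ y∉M₁)

  T-renV-shadowed : ∀ s V₁ V M → occurs y s ≡ false → Any (λ l → elem x l ≡ true) V₁ →
                    T (V₁ ++ θ ∷ V) M s ≡ T (V₁ ++ θ' ∷ V) M s
  T-renV-shadowed (mat z) V₁ V M y∉ sh = refl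
  T-renV-shadowed (var z) V₁ V M y∉ sh rewrite T-var (V₁ ++ θ ∷ V) M z | T-var (V₁ ++ θ' ∷ V) M z with z ≡ᵇ x in z≡x
  ... | true  rewrite ≡ᵇ-sound z x z≡x = cong (Maybe.map vmk) (idx-shadow x V₁ θ θ' V sh)
  ... | false = cong (Maybe.map vmk) (idx-other z V₁ V (≡ᵇ-false⇒≢ z x z≡x) (y≢ z y∉))
  T-renV-shadowed (app t u) V₁ V M y∉ sh rewrite T-app (V₁ ++ θ ∷ V) M t u | T-app (V₁ ++ θ' ∷ V) M t u =
    cong₂ (comb app) (T-renV-shadowed t V₁ V M (∨-conicalˡ (occurs y t) (occurs y u) y∉) sh)
                     (T-renV-shadowed u V₁ V M (∨-conicalʳ (occurs y t) _ y∉) sh)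
  T-renV-shadowed (lam θ₁ p s) V₁ V M y∉ sh with y∉lam θ₁ p s y∉
  ... | _ , y∉p , y∉s rewrite T-lam (V₁ ++ θ ∷ V) M θ₁ p s | T-lam (V₁ ++ θ' ∷ V) M θ₁ p s =
    cong₂ (comb (lam (length θ₁))) (T-renV-shadowed p V₁ V (θ₁ ∷ M) y∉p sh)
                                   (T-renV-shadowed s (θ₁ ∷ V₁) V M y∉s (there sh))

  T-renV : ∀ s V₁ V M → occurs y s ≡ false →
           All (λ l → elem x l ≡ false) V₁ → All (λ l → elem y l ≡ false) V₁ →
           T (V₁ ++ θ ∷ V) M s ≡ T (V₁ ++ θ' ∷ V) M (renV x y s)
  T-renV (mat z) V₁ V M y∉ x∉V₁ y∉V₁ = refl
  T-renV (var z) V₁ V M y∉ x∉V₁ y∉V₁ with z ≡ᵇ x in z≡x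
  ... | true  rewrite ≡ᵇ-sound z x z≡x | T-var (V₁ ++ θ ∷ V) M x | T-var (V₁ ++ θ' ∷ V) M y =
    cong (Maybe.map vmk) (idx-renamed V₁ V x∉V₁ y∉V₁)
  ... | false rewrite T-var (V₁ ++ θ ∷ V) M z | T-var (V₁ ++ θ' ∷ V) M z =
    cong (Maybe.map vmk) (idx-other z V₁ V (≡ᵇ-false⇒≢ z x z≡x) (y≢ z y∉))
  T-renV (app t u) V₁ V M y∉ x∉V₁ y∉V₁
    rewrite T-app (V₁ ++ θ ∷ V) M t u | T-app (V₁ ++ θ' ∷ V) M (renV x y t) (renV x y u) =
    cong₂ (comb app) (T-renV t V₁ V M (∨-conicalˡ (occurs y t) (occurs y u) y∉) x∉V₁ y∉V₁)
                     (T-renV u V₁ V M (∨-conicalʳ (occurs y t) _ y∉) x∉V₁ y∉V₁)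
  T-renV (lam θ₁ p s) V₁ V M y∉ x∉V₁ y∉V₁ with y∉lam θ₁ p s y∉ | elem x θ₁ in x∈θ₁
  ... | _ , y∉p , y∉s | true
    rewrite T-lam (V₁ ++ θ ∷ V) M θ₁ p s | T-lam (V₁ ++ θ' ∷ V) M θ₁ (renV x y p) s =
    cong₂ (comb (lam (length θ₁))) (T-renV p V₁ V (θ₁ ∷ M) y∉p x∉V₁ y∉V₁)
                                   (T-renV-shadowed s (θ₁ ∷ V₁) V M y∉s (here x∈θ₁))
  ... | y∉θ₁ , y∉p , y∉s | false
    rewrite T-lam (V₁ ++ θ ∷ V) M θ₁ p s | T-lam (V₁ ++ θ' ∷ V) M θ₁ (renV x y p) (renV x y s) =
    cong₂ (comb (lam (length θ₁))) (T-renV p V₁ V (θ₁ ∷ M) y∉p x∉V₁ y∉V₁)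
                                   (T-renV s (θ₁ ∷ V₁) V M y∉s (x∈θ₁ ∷ x∉V₁) (y∉θ₁ ∷ y∉V₁))

  T-rename : ∀ V M p s → occurs y (lam θ p s) ≡ false →
             T V M (lam θ p s) ≡ T V M (lam θ' (renM x y p) (renV x y s))
  T-rename V M p s y∉ with y∉lam θ p s y∉
  ... | _ , y∉p , y∉s rewrite T-lam V M θ p s | T-lam V M θ' (renM x y p) (renV x y s) | length-map rn θ =
    cong₂ (comb (lam (length θ))) (T-renM p V [] M y∉p [] []) (T-renV s [] V M y∉s [] [])

  -- Away from y the renaming is injective, so renaming x to a symbol
  -- y ∉ θ₀ keeps θ₀ duplicate-free.
  rn-injective-off-y : ∀ a b → a ≢ b → a ≢ y → b ≢ y → rn a ≢ rn b
  rn-injective-off-y a b a≢b a≢y b≢y eq with a ≡ᵇ x in a≡x | b ≡ᵇ x in b≡x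
  ... | true  | true  = a≢b (trans (≡ᵇ-sound a x a≡x) (sym (≡ᵇ-sound b x b≡x)))
  ... | true  | false = b≢y (sym eq)
  ... | false | true  = a≢y eq
  ... | false | false = a≢b eq

  unique-rename : ∀ θ₀ → elem y θ₀ ≡ false → Unique θ₀ → Unique (map rn θ₀)
  unique-rename []       _ []          = []
  unique-rename (a ∷ θ₀) h (a∉θ₀ ∷ uθ₀) =
    distinct θ₀ (∨-conicalʳ (y ≡ᵇ a) _ h) a∉θ₀ ∷ unique-rename θ₀ (∨-conicalʳ (y ≡ᵇ a) _ h) uθ₀
    where
    a≢y = y≢ a (∨-conicalˡ (y ≡ᵇ a) _ h)
    distinct : ∀ bs → elem y bs ≡ false → All (a ≢_) bs → All (rn a ≢_) (map rn bs)
    distinct []       _ []           = []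
    distinct (b ∷ bs) h' (a≢b ∷ a∉bs) =
      rn-injective-off-y a b a≢b a≢y (y≢ b (∨-conicalˡ (y ≡ᵇ b) _ h')) ∷ distinct bs (∨-conicalʳ (y ≡ᵇ b) _ h') a∉bs

-- Renaming free symbols does not touch binder lists.
unique-renM : ∀ x y p → UniqueBinders p → UniqueBinders (renM x y p)
unique-renM x y (var z)     u = u
unique-renM x y (mat z)     u with z ≡ᵇ x
... | true  = _
... | false = _
unique-renM x y (app t s)   (ut , us) = unique-renM x y t ut , unique-renM x y s us
unique-renM x y (lam θ p s) (uθ , up , us) with elem x θ
... | true  = uθ , up , unique-renM x y s us
... | false = uθ , unique-renM x y p up , unique-renM x y s us

unique-renM⁻ : ∀ x y p → UniqueBinders (renM x y p) → UniqueBinders p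
unique-renM⁻ x y (var z)     u = u
unique-renM⁻ x y (mat z)     u = _
unique-renM⁻ x y (app t s)   (ut , us) = unique-renM⁻ x y t ut , unique-renM⁻ x y s us
unique-renM⁻ x y (lam θ p s) u with elem x θ | u
... | true  | (uθ , up , us) = uθ , up , unique-renM⁻ x y s us
... | false | (uθ , up , us) = uθ , unique-renM⁻ x y p up , unique-renM⁻ x y s us

unique-renV : ∀ x y s → UniqueBinders s → UniqueBinders (renV x y s)
unique-renV x y (mat z)     u = u
unique-renV x y (var z)     u with z ≡ᵇ x
... | true  = _
... | false = _
unique-renV x y (app t s)   (ut , us) = unique-renV x y t ut , unique-renV x y s us
unique-renV x y (lam θ p s) (uθ , up , us) with elem x θ
... | true  = uθ , unique-renV x y p up , us
... | false = uθ , unique-renV x y p up , unique-renV x y s us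

unique-renV⁻ : ∀ x y s → UniqueBinders (renV x y s) → UniqueBinders s
unique-renV⁻ x y (mat z)     u = u
unique-renV⁻ x y (var z)     u = _
unique-renV⁻ x y (app t s)   (ut , us) = unique-renV⁻ x y t ut , unique-renV⁻ x y s us
unique-renV⁻ x y (lam θ p s) u with elem x θ | u
... | true  | (uθ , up , us) = uθ , unique-renV⁻ x y p up , us
... | false | (uθ , up , us) = uθ , unique-renV⁻ x y p up , unique-renV⁻ x y s us

record αInvariant (t u : Term) : Set where
  field
    same-T   : ∀ V M → T V M t ≡ T V M u
    unique→ : UniqueBinders t → UniqueBinders u
    unique← : UniqueBinders u → UniqueBinders t
open αInvariant

α-invariant : ∀ {t u} → t ≈α u → αInvariant t u
α-invariant α-refl = record { same-T = λ _ _ → refl ; unique→ = λ z → z ; unique← = λ z → z }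
α-invariant (α-sym r) = record { same-T = λ V M → sym (same-T i V M) ; unique→ = unique← i ; unique← = unique→ i }
  where i = α-invariant r
α-invariant (α-trans r r') = record
  { same-T  = λ V M → trans (same-T i V M) (same-T i' V M)
  ; unique→ = λ z → unique→ i' (unique→ i z)
  ; unique← = λ z → unique← i (unique← i' z) }
  where i = α-invariant r; i' = α-invariant r'
α-invariant (α-app {t} {t'} {u} {u'} r r') = record
  { same-T  = λ V M → trans (T-app V M t u) (trans (cong₂ (comb app) (same-T i V M) (same-T i' V M))
                                                   (sym (T-app V M t' u')))
  ; unique→ = λ { (a , b) → unique→ i a , unique→ i' b }
  ; unique← = λ { (a , b) → unique← i a , unique← i' b } }
  where i = α-invariant r; i' = α-invariant r'
α-invariant (α-lam {θ} {p} {p'} {s} {s'} r r') = record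
  { same-T  = λ V M → trans (T-lam V M θ p s)
                            (trans (cong₂ (comb (lam (length θ))) (same-T i V (θ ∷ M)) (same-T i' (θ ∷ V) M))
                                   (sym (T-lam V M θ p' s')))
  ; unique→ = λ { (a , b , c) → a , unique→ i b , unique→ i' c }
  ; unique← = λ { (a , b , c) → a , unique← i b , unique← i' c } }
  where i = α-invariant r; i' = α-invariant r'
α-invariant (α-ren {θ} {p} {s} x y x∈θ y∉) = record
  { same-T  = λ V M → T-rename V M p s y∉
  ; unique→ = λ { (a , b , c) → unique-rename θ y∉θ a , unique-renM x y p b , unique-renV x y s c }
  ; unique← = λ { (a , b , c) → Unique.map⁻ a , unique-renM⁻ x y p b , unique-renV⁻ x y s c } }
  where
  y∉θ = ∨-conicalˡ (elem y θ) _ y∉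
  open Renaming x y θ x∈θ y∉θ

-- The pattern is translated in V, θ ∷ M and the argument,
-- moved under the abstraction, in [] ∷ V, M.  A PPC match and a dB match
-- correspond when both fail, both wait, or both succeed with substitutions
-- related entrywise: x ↦ u corresponds to j ↦ a when j is the position of
-- x in θ and a translates u.
module Matching (V M : List (List Sym)) (θ : List Sym) where

  Entry : Sym × Term → ℕ × DB → Set
  Entry (x , u) (j , a) = posIn x θ ≡ just j × T ([] ∷ V) M u ≡ just a

  data Corr : Match PSubst → Match DSubst → Set where
    ok   : ∀ {σ σD} → Pointwise Entry σ σD → Corr (ok σ) (ok σD)
    fail : Corr fail fail
    wait : Corr wait wait

  elem-dom : ∀ x j τ τD → posIn x θ ≡ just j → Pointwise Entry τ τD →
             elem x (pdom τ) ≡ elem j (ddom τD)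
  elem-dom x j [] [] ex [] = refl
  elem-dom x j ((x' , u) ∷ τ) ((j' , a) ∷ τD) ex ((ex' , _) ∷ τ~)
    rewrite posIn-≡ᵇ x x' θ j j' ex ex' | elem-dom x j τ τD ex τ~ = refl

  disjoint-dom : ∀ σ σD τ τD → Pointwise Entry σ σD → Pointwise Entry τ τD →
                 disjointB (pdom σ) (pdom τ) ≡ disjointB (ddom σD) (ddom τD)
  disjoint-dom [] [] τ τD [] τ~ = refl
  disjoint-dom ((x , u) ∷ σ) ((j , a) ∷ σD) τ τD ((ex , _) ∷ σ~) τ~
    rewrite elem-dom x j τ τD ex τ~ | disjoint-dom σ σD τ τD σ~ τ~ = refl

  ⊎-corr : ∀ {μ μD ν νD} → Corr μ μD → Corr ν νD → Corr (μ ⊎P ν) (μD ⊎D νD)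
  ⊎-corr fail   _      = fail
  ⊎-corr (ok _) fail   = fail
  ⊎-corr wait   fail   = fail
  ⊎-corr wait   (ok _) = wait
  ⊎-corr wait   wait   = wait
  ⊎-corr (ok _) wait   = wait
  ⊎-corr (ok {σ} {σD} σ~) (ok {τ} {τD} τ~) rewrite disjoint-dom σ σD τ τD σ~ τ~
    with disjointB (ddom σD) (ddom τD)
  ... | true  = ok (++⁺ σ~ τ~)
  ... | false = fail

  match-stuck : ∀ p u p' u' → T V (θ ∷ M) p ≡ just p' → T ([] ∷ V) M u ≡ just u' →
                Corr (if isMF p ∧ isMF u then fail else wait) (if isMFd p' ∧ isMFd u' then fail else wait)
  match-stuck p u p' u' hp hu rewrite isMF-T V (θ ∷ M) p p' hp | isMF-T ([] ∷ V) M u u' hu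
    with isMFd p' ∧ isMFd u'
  ... | true  = fail
  ... | false = wait

  match₀-corr   : ∀ p u p' u' → T V (θ ∷ M) p ≡ just p' → T ([] ∷ V) M u ≡ just u' →
                  Corr (pmatch₀ θ p u) (dmatch₀ p' u')
  matchRest-corr : ∀ p u p' u' → T V (θ ∷ M) p ≡ just p' → T ([] ∷ V) M u ≡ just u' →
                   Corr (pmatchRest θ p u) (dmatchRest p' u')

  -- Applications are matched componentwise exactly when both sides are
  -- matchable forms, which the translation reflects.
  matchRest-corr p u p' u' hp hu with T-shape V (θ ∷ M) p p' hp
  ... | var = match-stuck p u p' u' hp hu
  ... | mat = match-stuck p u p' u' hp hu
  ... | lam = match-stuck p u p' u' hp hu
  matchRest-corr (app p₁ p₂) u (app a₁ a₂) u' hp hu | app with T-shape ([] ∷ V) M u u' hu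
  ... | var = match-stuck (app p₁ p₂) u _ u' hp hu
  ... | mat = match-stuck (app p₁ p₂) u _ u' hp hu
  ... | lam = match-stuck (app p₁ p₂) u _ u' hp hu
  matchRest-corr (app p₁ p₂) (app u₁ u₂) (app a₁ a₂) (app b₁ b₂) hp hu | app | app
    with T-app-inv V (θ ∷ M) p₁ p₂ _ hp | T-app-inv ([] ∷ V) M u₁ u₂ _ hu
  ... | _ , _ , hp₁ , hp₂ , refl | _ , _ , hu₁ , hu₂ , refl
    rewrite isMF-T V (θ ∷ M) (app p₁ p₂) _ hp | isMF-T ([] ∷ V) M (app u₁ u₂) _ hu
    with isMFd (app a₁ a₂) ∧ isMFd (app b₁ b₂)
  ... | true  = ⊎-corr (match₀-corr p₁ u₁ a₁ b₁ hp₁ hu₁) (match₀-corr p₂ u₂ a₂ b₂ hp₂ hu₂)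
  ... | false = match-stuck (app p₁ p₂) (app u₁ u₂) _ _ hp hu

  -- A matchable x̂ bound by the pattern (index 𝗆_{1,j}) matches anything.
  match-bound : ∀ x j u u' → posIn x θ ≡ just j → T ([] ∷ V) M u ≡ just u' →
                Corr (pmatch₀ θ (mat x) u) (dmatch₀ (m 1 j) u')
  match-bound x j u u' ex hu rewrite posIn-elem x θ j ex = ok ((ex , hu) ∷ [])

  -- A free matchable x̂ (index 𝗆_{i+2,j}) matches exactly the same free
  -- matchable, which under the abstraction has index 𝗆_{i+1,j}.
  match-free : ∀ x i j u u' → elem x θ ≡ false → idx x M ≡ just (suc i , j) →
               T V (θ ∷ M) (mat x) ≡ just (m (suc (suc i)) j) → T ([] ∷ V) M u ≡ just u' →
               Corr (pmatch₀ θ (mat x) u) (dmatch₀ (m (suc (suc i)) j) u')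
  match-free x i j u u' x∉θ ex hp hu rewrite x∉θ with T-shape ([] ∷ V) M u u' hu
  ... | var = matchRest-corr (mat x) u _ u' hp hu
  ... | app = matchRest-corr (mat x) u _ u' hp hu
  ... | lam = matchRest-corr (mat x) u _ u' hp hu
  match-free x i j (mat y) (m i' j') x∉θ ex hp hu | mat
    with map-just-inv mmk (idx y M) _ (trans (sym (T-mat ([] ∷ V) M y)) hu)
  ... | _ , ey , refl rewrite idx-≡ᵇ x y M (suc i) j i' j' ex ey with (suc i ≡ᵇ i') ∧ (j ≡ᵇ j')
  ...   | true  = ok []
  ...   | false = fail

  match₀-corr (var x) u p' u' hp hu with T-shape V (θ ∷ M) (var x) p' hp
  ... | var = matchRest-corr (var x) u p' u' hp hu
  match₀-corr (app p₁ p₂) u p' u' hp hu with T-shape V (θ ∷ M) (app p₁ p₂) p' hp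
  ... | app = matchRest-corr (app p₁ p₂) u p' u' hp hu
  match₀-corr (lam θ₁ p₁ s₁) u p' u' hp hu with T-shape V (θ ∷ M) (lam θ₁ p₁ s₁) p' hp
  ... | lam = matchRest-corr (lam θ₁ p₁ s₁) u p' u' hp hu
  match₀-corr (mat x) u p' u' hp hu
    with idx-view x θ M | map-just-inv mmk (idx x (θ ∷ M)) p' (trans (sym (T-mat V (θ ∷ M) x)) hp)
  ... | inj₁ (j , ex , e) | _ , e' , refl with trans (sym e') e
  ...   | refl = match-bound x j u u' ex hu
  match₀-corr (mat x) u p' u' hp hu | inj₂ (ex , e) | (i , j) , e' , refl
    with map-incr-inv (idx x M) i j (trans (sym e) e')
  ... | i₀ , refl , eM with idx-layer-pos x M i₀ j eM
  ...   | i₁ , refl = match-free x i₁ j u u' (posIn-nothing⁻ x θ ex) eM hp hu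

  -- The domain check: σ covers exactly θ iff σD covers exactly 1..|θ|,
  -- using that positions enumerate the duplicate-free θ.
  dom⊆θ : ∀ σ σD → Pointwise Entry σ σD → allB (λ x → elem x θ) (pdom σ) ≡ true
  dom⊆θ [] [] [] = refl
  dom⊆θ ((x , u) ∷ σ) ((j , a) ∷ σD) ((ex , _) ∷ σ~) rewrite posIn-elem x θ j ex = dom⊆θ σ σD σ~

  ddom⊆range : ∀ σ σD → Pointwise Entry σ σD → allB (λ j → elem j (oneTo (length θ))) (ddom σD) ≡ true
  ddom⊆range [] [] [] = refl
  ddom⊆range ((x , u) ∷ σ) ((j , a) ∷ σD) ((ex , _) ∷ σ~) with posIn-range x θ j ex
  ... | k , refl , k<|θ| rewrite oneTo-intro (length θ) k k<|θ| = ddom⊆range σ σD σ~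

  covers-corr : ∀ σ σD → Unique θ → Pointwise Entry σ σD →
                allB (λ y → elem y (pdom σ)) θ ≡ allB (λ k → elem k (ddom σD)) (oneTo (length θ))
  covers-corr σ σD uθ σ~ = bool-ext _ _ covers-range covers-θ
    where
    covers-range : allB (λ y → elem y (pdom σ)) θ ≡ true → allB (λ k → elem k (ddom σD)) (oneTo (length θ)) ≡ true
    covers-range h = allB-intro _ (oneTo (length θ)) λ k k∈ → at (oneTo-elim (length θ) k k∈)
      where
      at : ∀ {k} → (Σ ℕ λ k' → k ≡ suc k' × k' < length θ) → elem k (ddom σD) ≡ true
      at (k' , refl , lt) with unique-pos θ k' uθ lt
      ... | y , ey = trans (sym (elem-dom y (suc k') σ σD ey σ~)) (allB-elim _ θ y h (posIn-elem y θ _ ey))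
    covers-θ : allB (λ k → elem k (ddom σD)) (oneTo (length θ)) ≡ true → allB (λ y → elem y (pdom σ)) θ ≡ true
    covers-θ h = allB-intro _ θ λ y y∈θ → at y (elem-posIn y θ y∈θ)
      where
      at : ∀ y → (Σ ℕ λ k → posIn y θ ≡ just k) → elem y (pdom σ) ≡ true
      at y (k , ey) with posIn-range y θ k ey
      ... | k' , refl , lt = trans (elem-dom y (suc k') σ σD ey σ~)
                                   (allB-elim _ (oneTo (length θ)) (suc k') h (oneTo-intro (length θ) k' lt))

  sameSet-corr : ∀ σ σD → Unique θ → Pointwise Entry σ σD →
                 sameSet (pdom σ) θ ≡ sameSet (ddom σD) (oneTo (length θ))
  sameSet-corr σ σD uθ σ~ =
    cong₂ _∧_ (trans (dom⊆θ σ σD σ~) (sym (ddom⊆range σ σD σ~))) (covers-corr σ σD uθ σ~)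

  match-corr : ∀ p u p' u' → Unique θ → T V (θ ∷ M) p ≡ just p' → T ([] ∷ V) M u ≡ just u' →
               Corr (pmatch θ p u) (dmatch (length θ) p' u')
  match-corr p u p' u' uθ hp hu with pmatch₀ θ p u | dmatch₀ p' u' | match₀-corr p u p' u' hp hu
  ... | ok σ | ok σD | ok σ~ rewrite sameSet-corr σ σD uθ σ~ with sameSet (ddom σD) (oneTo (length θ))
  ...   | true  = ok σ~
  ...   | false = fail
  match-corr p u p' u' uθ hp hu | fail | fail | fail = fail
  match-corr p u p' u' uθ hp hu | wait | wait | wait = wait

  lookup-corr : ∀ σ σD x j u → Pointwise Entry σ σD → posIn x θ ≡ just j → plookup x σ ≡ just u →
                Σ DB λ a → dlookup j σD ≡ just a × T ([] ∷ V) M u ≡ just a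
  lookup-corr ((y , u') ∷ σ) ((j' , a) ∷ σD) x j u ((ey , hu') ∷ σ~) ex pl
    rewrite posIn-≡ᵇ x y θ j j' ex ey with j ≡ᵇ j'
  ... | true with pl
  ...   | refl = a , refl , hu'
  lookup-corr ((y , u') ∷ σ) ((j' , a) ∷ σD) x j u ((ey , hu') ∷ σ~) ex pl | false =
    lookup-corr σ σD x j u σ~ ex pl

  lookup-outside : ∀ σ σD x → Pointwise Entry σ σD → posIn x θ ≡ nothing → plookup x σ ≡ nothing
  lookup-outside [] [] x [] ex = refl
  lookup-outside ((y , u') ∷ σ) ((j' , a) ∷ σD) x ((ey , _) ∷ σ~) ex with x ≡ᵇ y in x≡y
  ... | true rewrite ≡ᵇ-sound x y x≡y with trans (sym ex) ey
  ...   | ()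
  lookup-outside ((y , u') ∷ σ) ((j' , a) ∷ σD) x ((ey , _) ∷ σ~) ex | false = lookup-outside σ σD x σ~ ex

-- Substitution.  PPC substitution removes the bound symbols of an
-- abstraction from σ on entering its body; de Bruijn substitution instead
-- raises the level and shifts the substituted terms.

remove-bound : ∀ x θ₁ σ → elem x θ₁ ≡ true → plookup x (remove θ₁ σ) ≡ nothing
remove-bound x θ₁ [] h = refl
remove-bound x θ₁ ((y , u) ∷ σ) h with elem y θ₁ in y∈θ₁
... | true  = remove-bound x θ₁ σ h
... | false with x ≡ᵇ y in x≡y
...   | true rewrite ≡ᵇ-sound x y x≡y = ⊥-elim (true≢false (trans (sym h) y∈θ₁))
...   | false = remove-bound x θ₁ σ h

remove-other : ∀ x θ₁ σ → elem x θ₁ ≡ false → plookup x (remove θ₁ σ) ≡ plookup x σ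
remove-other x θ₁ [] h = refl
remove-other x θ₁ ((y , u) ∷ σ) h with elem y θ₁ in y∈θ₁
... | true with x ≡ᵇ y in x≡y
...   | true rewrite ≡ᵇ-sound x y x≡y = ⊥-elim (true≢false (trans (sym y∈θ₁) h))
...   | false = remove-other x θ₁ σ h
remove-other x θ₁ ((y , u) ∷ σ) h | false with x ≡ᵇ y
... | true  = refl
... | false = remove-other x θ₁ σ h

dlookup-mapD : ∀ (f : DB → DB) j σD → dlookup j (mapD f σD) ≡ Maybe.map f (dlookup j σD)
dlookup-mapD f j [] = refl
dlookup-mapD f j ((j' , a) ∷ σD) with j ≡ᵇ j'
... | true  = refl
... | false = dlookup-mapD f j σD

-- The substitution lemma is proved for a body s translated in a context
-- V₁ ++ θ ∷ V, where the layer θ (at level |V₁| + 1) is being substituted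
-- and V₁ collects the binders crossed so far.
module Substitution (V : List (List Sym)) (θ : List Sym) where

  record Image (V₁ Mc : List (List Sym)) (σ : PSubst) (σD : DSubst) (s : Term) (x : Sym) (j : ℕ) : Set where
    constructor image
    field
      {term}     : Term
      {db}       : DB
      σx         : plookup x σ ≡ just term
      σDj        : dlookup j σD ≡ just db
      translates : T (V₁ ++ [] ∷ V) Mc term ≡ just db
      uncaptured : Fresh (binders s) term

  record Invariant (V₁ Mc : List (List Sym)) (σ : PSubst) (σD : DSubst) (s : Term) : Set where
    constructor invariant
    field
      bound   : ∀ x j → idx x (V₁ ++ θ ∷ V) ≡ just (suc (length V₁) , j) → Image V₁ Mc σ σD s x j
      unbound : ∀ x i j → idx x (V₁ ++ θ ∷ V) ≡ just (i , j) → i ≢ suc (length V₁) → plookup x σ ≡ nothing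
  open Invariant

  -- The invariant passes to subterms with fewer binders …
  inv-sub : ∀ {V₁ Mc σ σD} s s₂ → (∀ z → elem z (binders s₂) ≡ true → elem z (binders s) ≡ true) →
            Invariant V₁ Mc σ σD s → Invariant V₁ Mc σ σD s₂
  inv-sub s s₂ w I = invariant (λ x j e → narrow (bound I x j e)) (unbound I)
    where
    narrow : ∀ {V₁ Mc σ σD x j} → Image V₁ Mc σ σD s x j → Image V₁ Mc σ σD s₂ x j
    narrow (image σx σDj tr fr) = image σx σDj tr (λ z ez → fr z (w z ez))

  module _ (θ₁ : List Sym) (p s : Term) where

    private
      fresh-θ₁ : ∀ u → Fresh (binders (lam θ₁ p s)) u → Fresh θ₁ u
      fresh-θ₁ u f = fresh-++ˡ θ₁ _ u f
      fresh-p : ∀ u → Fresh (binders (lam θ₁ p s)) u → Fresh (binders p) u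
      fresh-p u f = fresh-++ˡ (binders p) (binders s) u (fresh-++ʳ θ₁ _ u f)
      fresh-s : ∀ u → Fresh (binders (lam θ₁ p s)) u → Fresh (binders s) u
      fresh-s u f = fresh-++ʳ (binders p) (binders s) u (fresh-++ʳ θ₁ _ u f)

    -- … into the pattern of an abstraction, with the substituted terms
    -- shifted past its matchables (weakening) …
    inv-pat : ∀ {V₁ Mc σ σD} → Invariant V₁ Mc σ σD (lam θ₁ p s) →
              Invariant V₁ (θ₁ ∷ Mc) σ (mapD (↑m 0) σD) p
    inv-pat {V₁} {Mc} {σ} {σD} I = invariant (λ x j e → into (bound I x j e)) (unbound I)
      where
      into : ∀ {x j} → Image V₁ Mc σ σD (lam θ₁ p s) x j → Image V₁ (θ₁ ∷ Mc) σ (mapD (↑m 0) σD) p x j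
      into (image {u} σx σDj tr fr) =
        image σx (trans (dlookup-mapD (↑m 0) _ σD) (cong (Maybe.map (↑m 0)) σDj))
              (trans (weaken-M u (V₁ ++ [] ∷ V) [] θ₁ Mc (fresh-θ₁ u fr)) (cong (Maybe.map (↑m 0)) tr))
              (fresh-p u fr)

    -- … and into its body, where θ₁ shadows and σ forgets the symbols of θ₁.
    inv-body : ∀ {V₁ Mc σ σD} → Invariant V₁ Mc σ σD (lam θ₁ p s) →
               Invariant (θ₁ ∷ V₁) Mc (remove θ₁ σ) (mapD (↑v 0) σD) s
    inv-body {V₁} {Mc} {σ} {σD} I = invariant bound' unbound'
      where
      bound' : ∀ x j → idx x (θ₁ ∷ V₁ ++ θ ∷ V) ≡ just (suc (suc (length V₁)) , j) →
               Image (θ₁ ∷ V₁) Mc (remove θ₁ σ) (mapD (↑v 0) σD) s x j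
      bound' x j e with idx-view x θ₁ (V₁ ++ θ ∷ V)
      ... | inj₁ (_ , _ , e₁) with trans (sym e) e₁
      ...   | ()
      bound' x j e | inj₂ (x∉θ₁ , e₁) with map-incr-inv (idx x (V₁ ++ θ ∷ V)) _ j (trans (sym e₁) e)
      ... | _ , refl , e₂ with bound I x j e₂
      ...   | image {u} σx σDj tr fr =
        image (trans (remove-other x θ₁ σ (posIn-nothing⁻ x θ₁ x∉θ₁)) σx)
              (trans (dlookup-mapD (↑v 0) _ σD) (cong (Maybe.map (↑v 0)) σDj))
              (trans (weaken-V u [] θ₁ (V₁ ++ [] ∷ V) Mc (fresh-θ₁ u fr)) (cong (Maybe.map (↑v 0)) tr))
              (fresh-s u fr)
      unbound' : ∀ x i j → idx x (θ₁ ∷ V₁ ++ θ ∷ V) ≡ just (i , j) → i ≢ suc (suc (length V₁)) →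
                 plookup x (remove θ₁ σ) ≡ nothing
      unbound' x i j e i≢ with idx-view x θ₁ (V₁ ++ θ ∷ V)
      ... | inj₁ (j' , x∈θ₁ , _) = remove-bound x θ₁ σ (posIn-elem x θ₁ j' x∈θ₁)
      ... | inj₂ (x∉θ₁ , e₁) with map-incr-inv (idx x (V₁ ++ θ ∷ V)) _ j (trans (sym e₁) e)
      ...   | i' , refl , e₂ = trans (remove-other x θ₁ σ (posIn-nothing⁻ x θ₁ x∉θ₁))
                                     (unbound I x i' j e₂ (λ q → i≢ (cong suc q)))

  subst-lemma : ∀ s V₁ Mc σ σD s' → Invariant V₁ Mc σ σD s → T (V₁ ++ θ ∷ V) Mc s ≡ just s' →
                T (V₁ ++ [] ∷ V) Mc (psubst σ s) ≡ just (dsubst (suc (length V₁)) σD s')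
  subst-lemma (var x) V₁ Mc σ σD s' I hs
    with map-just-inv vmk (idx x (V₁ ++ θ ∷ V)) s' (trans (sym (T-var (V₁ ++ θ ∷ V) Mc x)) hs)
  ... | (i , j) , ex , refl with i ≡ᵇ suc (length V₁) in i≡
  ...   | true with ≡ᵇ-sound i _ i≡
  ...     | refl with bound I x j ex
  ...       | image σx σDj tr _ rewrite σx | σDj = tr
  subst-lemma (var x) V₁ Mc σ σD s' I hs | (i , j) , ex , refl | false
    rewrite unbound I x i j ex (≡ᵇ-false⇒≢ i _ i≡) | T-var (V₁ ++ [] ∷ V) Mc x
          | idx-empty-layer x V₁ θ V i j ex (≡ᵇ-false⇒≢ i _ i≡) = refl
  subst-lemma (mat x) V₁ Mc σ σD s' I hs
    with map-just-inv mmk (idx x Mc) s' (trans (sym (T-mat (V₁ ++ θ ∷ V) Mc x)) hs)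
  ... | (i , j) , _ , refl = trans (T-mat (V₁ ++ [] ∷ V) Mc x) (trans (sym (T-mat (V₁ ++ θ ∷ V) Mc x)) hs)
  subst-lemma (app t u) V₁ Mc σ σD s' I hs with T-app-inv (V₁ ++ θ ∷ V) Mc t u s' hs
  ... | a , b , ea , eb , refl =
    T-app-just (V₁ ++ [] ∷ V) Mc (psubst σ t) (psubst σ u) _ _
      (subst-lemma t V₁ Mc σ σD a (inv-sub (app t u) t (λ z e → elem-++ˡ z (binders t) _ e) I) ea)
      (subst-lemma u V₁ Mc σ σD b (inv-sub (app t u) u (λ z e → elem-++ʳ z (binders t) _ e) I) eb)
  subst-lemma (lam θ₁ p s) V₁ Mc σ σD s' I hs with T-lam-inv (V₁ ++ θ ∷ V) Mc θ₁ p s s' hs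
  ... | a , b , ea , eb , refl =
    T-lam-just (V₁ ++ [] ∷ V) Mc θ₁ (psubst σ p) (psubst (remove θ₁ σ) s) _ _
      (subst-lemma p V₁ (θ₁ ∷ Mc) σ (mapD (↑m 0) σD) a (inv-pat θ₁ p s I) ea)
      (subst-lemma s (θ₁ ∷ V₁) Mc (remove θ₁ σ) (mapD (↑v 0) σD) b (inv-body θ₁ p s I) eb)

-- Moving a term under an empty binder layer is the shift ↑_0, and ↓_0
-- undoes it: this is how the argument enters, and the contractum leaves,
-- the abstraction in a dB β-step.
T-under-binder : ∀ V M u a → T V M u ≡ just a → T ([] ∷ V) M u ≡ just (↑v 0 a)
T-under-binder V M u a e = trans (weaken-V u [] [] V M (fresh-[] u)) (cong (Maybe.map (↑v 0)) e)

T-out-of-binder : ∀ V M t b → T ([] ∷ V) M t ≡ just b → T V M t ≡ just (↓v 0 b)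
T-out-of-binder V M t b e with map-just-inv (↑v 0) (T V M t) b (trans (sym (weaken-V t [] [] V M (fresh-[] t))) e)
... | c , ec , refl = trans ec (cong just (sym (↓v-↑v 0 c)))

pmatch-dom : ∀ θ p u σ → pmatch θ p u ≡ ok σ → sameSet (pdom σ) θ ≡ true
pmatch-dom θ p u σ h with pmatch₀ θ p u
... | ok σ' with sameSet (pdom σ') θ in e
...   | true with h
...     | refl = e
pmatch-dom θ p u σ () | ok σ' | false
pmatch-dom θ p u σ () | fail
pmatch-dom θ p u σ () | wait

plookup-defined : ∀ x σ → elem x (pdom σ) ≡ true → Σ Term λ u → plookup x σ ≡ just u
plookup-defined x ((y , u) ∷ σ) e with x ≡ᵇ y
... | true  = u , refl
... | false = plookup-defined x σ e

allB-plookup : ∀ (g : Sym × Term → Bool) σ x u → allB g σ ≡ true → plookup x σ ≡ just u → g (x , u) ≡ true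
allB-plookup g ((y , u') ∷ σ) x u h e with x ≡ᵇ y in x≡y
... | true with e
...   | refl rewrite ≡ᵇ-sound x y x≡y = ∧-conicalˡ (g (y , u')) _ h
allB-plookup g ((y , u') ∷ σ) x u h e | false = allB-plookup g σ x u (∧-conicalʳ (g (y , u')) _ h) e

noCapture-at : ∀ σ s x u → noCapture σ s ≡ true → plookup x σ ≡ just u → Fresh (binders s) u
noCapture-at σ s x u nc σx z z∈ =
  not-true _ (allB-plookup _ σ x u (allB-elim (λ z → allB (λ { (_ , u) → not (occurs z u) }) σ) (binders s) z nc z∈) σx)

module Contraction (V M : List (List Sym)) (θ : List Sym) where
  open Matching V M θ
  open Substitution V θ

  initial-invariant : ∀ s σ σD → Pointwise Entry σ σD → sameSet (pdom σ) θ ≡ true → noCapture σ s ≡ true →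
                      Invariant [] M σ σD s
  initial-invariant s σ σD σ~ dom nc = invariant bound unbound
    where
    bound : ∀ x j → idx x (θ ∷ V) ≡ just (1 , j) → Image [] M σ σD s x j
    bound x j e with idx-view x θ V
    ... | inj₂ (_ , e₁) with map-incr-inv (idx x V) 1 j (trans (sym e₁) e)
    ...   | .0 , refl , e₂ = ⊥-elim (idx-layer≢0 x V j e₂)
    bound x j e | inj₁ (j' , ex , e₁) with trans (sym e) e₁
    ... | refl with plookup-defined x σ (allB-elim _ θ x (∧-conicalʳ _ _ dom) (posIn-elem x θ j ex))
    ...   | u , σx with lookup-corr σ σD x j u σ~ ex σx
    ...     | a , σDj , tr = image σx σDj tr (noCapture-at σ s x u nc σx)
    unbound : ∀ x i j → idx x (θ ∷ V) ≡ just (i , j) → i ≢ 1 → plookup x σ ≡ nothing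
    unbound x i j e i≢1 with idx-view x θ V
    ... | inj₁ (_ , _ , e₁) with trans (sym e) e₁
    ...   | refl = ⊥-elim (i≢1 refl)
    unbound x i j e i≢1 | inj₂ (x∉θ , _) = lookup-outside σ σD x σ~ x∉θ

  β-ok-sim : ∀ p s u ap as au σ → Unique θ →
             T V (θ ∷ M) p ≡ just ap → T (θ ∷ V) M s ≡ just as → T V M u ≡ just au →
             pmatch θ p u ≡ ok σ → noCapture σ s ≡ true →
             Σ DSubst λ σD → dmatch (length θ) ap (↑v 0 au) ≡ ok σD ×
                             T V M (psubst σ s) ≡ just (↓v 0 (dsubst 1 σD as))
  β-ok-sim p s u ap as au σ uθ ep es eu hm nc
    with dmatch (length θ) ap (↑v 0 au)
       | subst (λ μ → Corr μ _) hm (match-corr p u ap (↑v 0 au) uθ ep (T-under-binder V M u au eu))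
  ... | ok σD | ok σ~ =
    σD , refl , T-out-of-binder V M (psubst σ s) _
                  (subst-lemma s [] M σ σD as (initial-invariant s σ σD σ~ (pmatch-dom θ p u σ hm) nc) es)

  β-fail-sim : ∀ p u ap au → Unique θ → T V (θ ∷ M) p ≡ just ap → T V M u ≡ just au →
               pmatch θ p u ≡ fail → dmatch (length θ) ap (↑v 0 au) ≡ fail
  β-fail-sim p u ap au uθ ep eu hm
    with dmatch (length θ) ap (↑v 0 au)
       | subst (λ μ → Corr μ _) hm (match-corr p u ap (↑v 0 au) uθ ep (T-under-binder V M u au eu))
  ... | fail | fail = refl

simulate : ∀ V M t t' a → UniqueBinders t → T V M t ≡ just a → t ⟶ʳ t' →
           Σ DB λ b → T V M t' ≡ just b × a ⟶dBʳ b
simulate V M (app (lam θ p s) u) _ c ((uθ , _) , _) ht (β-ok {σ = σ} hm nc)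
  with T-app-inv V M (lam θ p s) u c ht
... | l , au , el , eu , refl with T-lam-inv V M θ p s l el
...   | ap , as , ep , es , refl with Contraction.β-ok-sim V M θ p s u ap as au σ uθ ep es eu hm nc
...     | σD , dm , eσs = ↓v 0 (dsubst 1 σD as) , eσs , β-ok dm
simulate V M (app (lam θ p s) u) _ c ((uθ , _) , _) ht (β-fail hm)
  with T-app-inv V M (lam θ p s) u c ht
... | l , au , el , eu , refl with T-lam-inv V M θ p s l el
...   | ap , as , ep , es , refl =
  lam 1 (m 1 1) (v 1 1) , refl , β-fail (Contraction.β-fail-sim V M θ p u ap au uθ ep eu hm)
simulate V M (app t u) (app t' .u) c (ut , _) ht (ξ-appˡ r) with T-app-inv V M t u c ht
... | a , b , ea , eb , refl with simulate V M t t' a ut ea r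
...   | a' , ea' , r' = app a' b , T-app-just V M t' u a' b ea' eb , ξ-appˡ r'
simulate V M (app t u) (app .t u') c (_ , uu) ht (ξ-appʳ r) with T-app-inv V M t u c ht
... | a , b , ea , eb , refl with simulate V M u u' b uu eb r
...   | b' , eb' , r' = app a b' , T-app-just V M t u' a b' ea eb' , ξ-appʳ r'
simulate V M (lam θ p s) (lam .θ p' .s) c (_ , up , _) ht (ξ-pat r) with T-lam-inv V M θ p s c ht
... | a , b , ea , eb , refl with simulate V (θ ∷ M) p p' a up ea r
...   | a' , ea' , r' = lam (length θ) a' b , T-lam-just V M θ p' s a' b ea' eb , ξ-pat r'
simulate V M (lam θ p s) (lam .θ .p s') c (_ , _ , us) ht (ξ-body r) with T-lam-inv V M θ p s c ht
... | a , b , ea , eb , refl with simulate (θ ∷ V) M s s' b us eb r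
...   | b' , eb' , r' = lam (length θ) a b' , T-lam-just V M θ p s' a b' ea eb' , ξ-body r'

-- The dB step needs no permutation of secondary indices.
lemma5p2 : (V M : List (List Sym)) (t t' : Term) (a : DB) →
           UniqueBinders t → T V M t ≡ just a → t ⟶PPC t' →
           Σ DB (λ b → T V M t' ≡ just b × a ⟶dB b)
lemma5p2 V M t t' a ub ht (t₁ , t₂ , t≈t₁ , t₁⟶t₂ , t₂≈t') with α-invariant t≈t₁ | α-invariant t₂≈t'
... | α₁ | α₂ with simulate V M t₁ t₂ a (unique→ α₁ ub) (trans (sym (same-T α₁ V M)) ht) t₁⟶t₂
...   | b , eb , a⟶b = b , trans (sym (same-T α₂ V M)) eb , (a , b , p-refl , a⟶b , p-refl)
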